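{- Let $\mathbb{G}$ and $\mathbb{G}'$ be coloured ribbon graphs. Then $P(\mathbb{G}\vee\mathbb{G}')=P(\mathbb{G}\sqcup\mathbb{G}')$, for any join $\mathbb{G}\vee\mathbb{G}'$.
   Context: A ribbon graph $\mathbb{G}=(V,E)$ is a surface with boundary represented as a union of two finite sets of closed discs, vertices and edges, meeting in disjoint line segments, each on the boundary of exactly one vertex and one edge, each edge containing exactly two such segments. A coloured ribbon graph has a partition $\mathcal{V}$ of $V$ into vertex colour classes and a partition $\mathcal{B}$ of its boundary components into boundary colour classes. $\mathbb{G}\sqcup\mathbb{G}'$ is the disjoint union, with colour classes the classes of the two pieces. A join $\mathbb{G}\vee\mathbb{G}'$ is obtained by identifying an arc on the boundary of a vertex of $\mathbb{G}$ with an arc on the boundary of a vertex of $\mathbb{G}'$, the two vertices becoming a single vertex; the vertex colour classes of these two vertices are merged into one class, and the boundary colour classes of the two boundary components containing the arcs (which become one boundary component) are merged into one class. Parameters: for $A\subseteq E$, $b(A)$ = number of boundary components of ribbon subgraph $(V,A)$, $\rho(A)=\frac12(|A|+|V|-b(A))$; for a graph $H$, $r_H(A)$ is the rank (vertices minus components) of its spanning subgraph with edges $A$. $\mathbb{G}/\mathcal{V}$ is the graph on vertex colour classes with an edge for each edge of $\mathbb{G}$ joining the classes of its ends; $\mathbb{G}^*/\mathcal{B}$ is the graph on boundary colour classes with an edge for each edge $e$ joining the classes of the boundary components touching $e$. $r_1(A)=r_{\mathbb{G}/\mathcal{V}}(A)$, $r_2(A)=\rho(A)-r_{\mathbb{G}/\mathcal{V}}(A)$,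 $r_3(A)=r_{\mathbb{G}^*/\mathcal{B}}(E)-r_{\mathbb{G}^*/\mathcal{B}}(E\setminus A)$, $r_4(A)=|A|+r_{\mathbb{G}^*/\mathcal{B}}(E\setminus A)-r_{\mathbb{G}^*/\mathcal{B}}(E)-\rho(A)$. Define $P(\mathbb{G})=\sum_{A\subseteq E}b_{\mathrm{bs}}^{r_1(A)}b_{\mathrm{bp}}^{r_2(A)}b_{\mathrm{olc}}^{r_3(A)}b_{\mathrm{olh}}^{r_4(A)}$, a polynomial in $b_{\mathrm{bs}},b_{\mathrm{bp}}^{1/2},b_{\mathrm{olc}},b_{\mathrm{olh}}^{1/2}$ (all parameters computed in the coloured ribbon graph in question). -}

module Defs where

open import Data.Nat using (ℕ; zero; suc; _+_; _*_; _∸_; pred)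
open import Data.Bool using (Bool; true; false; if_then_else_; _∧_; _∨_; not)
open import Data.Fin using (Fin; zero; suc; _↑ˡ_; _↑ʳ_; splitAt; combine; punchIn; punchOut; _≟_)
open import Data.Fin.Subset using (Subset; ∁; ∣_∣) renaming (⊤ to fullSet)
open import Data.Vec using (Vec; []; _∷_; lookup)
open import Data.List using (List; []; _∷_; _++_; map; concatMap; foldl; filter; allFin; filterᵇ; length)
open import Data.List.Membership.Propositional using (_∈_)
open import Data.Bool.ListAction using (any)
open import Data.Maybe using (Maybe; just; nothing)
open import Data.List.Relation.Unary.Any using (any?)
open import Data.Product using (Σ; _×_; _,_; proj₁; proj₂)
open import Data.Product.Properties using (≡-dec)
open import Data.Sum using (_⊎_; inj₁; inj₂)
open import Data.Integer using (ℤ; +_; _-_) renaming (_+_ to _+ℤ_; _*_ to _*ℤ_)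
import Data.Integer.Properties as ℤP
open import Data.Unit using (⊤)
open import Data.Empty using (⊥)
open import Relation.Nullary using (¬_; Dec; yes; no)
open import Relation.Nullary.Decidable using (⌊_⌋)
open import Relation.Binary.PropositionalEquality using (_≡_; _≢_; refl; sym)

-- Components are computed by the
-- standard label-merging procedure: every vertex carries a label (a
-- vertex of its current class); processing an edge (u , v) relabels the
-- whole class of v by the label of u.

relabel : ∀ {n} → (Fin n → Fin n) → Fin n × Fin n → (Fin n → Fin n)
relabel l (u , v) x = if ⌊ l x ≟ l v ⌋ then l u else l x

labels : ∀ {n} → List (Fin n × Fin n) → Fin n → Fin n
labels es = foldl relabel (λ x → x) es

components : (n : ℕ) → List (Fin n × Fin n) → ℕ
components n es =
  length (filter (λ y → any? (λ x → labels es x ≟ y) (allFin n)) (allFin n))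

rank : (n : ℕ) → List (Fin n × Fin n) → ℕ
rank n es = n ∸ components n es

iter : ∀ {A : Set} → (A → A) → ℕ → A → A
iter f zero    a = a
iter f (suc k) a = f (iter f k a)

-- Coloured ribbon graphs, as signed rotation systems.
--
-- Every vertex disc carries a fixed orientation; next h is the half-edge
-- following h in the cyclic order around its vertex; twist e says
-- whether the edge ribbon e is twisted relative to the vertex
-- orientations.  Each attachment segment of a half-edge h has two
-- endpoints (h , 0) (first) and (h , 1) (second) in the vertex
-- orientation.  Vertex colour classes: the fibres of vcol.  Boundary
-- colour classes: the fibres of bcol, which is defined on boundary
-- points ("Point") and on vertices (the latter only meaningful for
-- vertices without incident edges, whose whole boundary circle is a
-- boundary component); WF requires bcol to be constant on boundary
-- components, so it is a colouring of boundary components.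

HalfEdge : ℕ → Set
HalfEdge nE = Fin nE × Fin 2

Point : ℕ → Set
Point nE = Fin nE × Fin 2 × Fin 2

record CRG : Set where
  field
    nV nE : ℕ
    vert  : Fin nE → Fin 2 → Fin nV
    next  : HalfEdge nE → HalfEdge nE
    twist : Fin nE → Bool
    kV    : ℕ
    vcol  : Fin nV → Fin kV
    kB    : ℕ
    bcol  : Fin nV ⊎ Point nE → Fin kB

open CRG public

_≟h_ : ∀ {n} → (h h' : HalfEdge n) → Dec (h ≡ h')
_≟h_ = ≡-dec _≟_ _≟_

enc : ∀ {nE} → Point nE → Fin (nE * 4)
enc (e , i , j) = combine e (combine {2} {2} i j)

IsolatedV : (G : CRG) → Fin (nV G) → Set
IsolatedV G v = ∀ e i → vert G e i ≢ v

hasEdge : (G : CRG) → Fin (nV G) → Bool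
hasEdge G v = any (λ e → ⌊ vert G e zero ≟ v ⌋ ∨ ⌊ vert G e (suc zero) ≟ v ⌋) (allFin (nE G))

-- number of vertices without incident edges (each is a boundary
-- component of every ribbon subgraph (V , A))
isolatedCount : CRG → ℕ
isolatedCount G = length (filterᵇ (λ v → not (hasEdge G v)) (allFin (nV G)))

allHalfEdges : (n : ℕ) → List (HalfEdge n)
allHalfEdges n = concatMap (λ e → (e , zero) ∷ (e , suc zero) ∷ []) (allFin n)

pattern 0F = zero
pattern 1F = suc zero

-- The boundary of the ribbon subgraph (V , A) as a 2-regular graph on
-- the boundary points: vertex-boundary arcs from the second endpoint
-- of h to the first endpoint of next h; attachment segments of
-- half-edges of edges not in A; and the two sides of each edge in A.
boundaryEdges : (G : CRG) → Subset (nE G) → List (Point (nE G) × Point (nE G))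
boundaryEdges G A =
  concatMap halfEdgePart (allHalfEdges (nE G)) ++ concatMap edgePart (allFin (nE G))
  where
  halfEdgePart : HalfEdge (nE G) → List (Point (nE G) × Point (nE G))
  halfEdgePart (e , i) =
    ((e , i , 1F) , (proj₁ (next G (e , i)) , proj₂ (next G (e , i)) , 0F))
    ∷ (if lookup A e then [] else ((e , i , 0F) , (e , i , 1F)) ∷ [])
  edgePart : Fin (nE G) → List (Point (nE G) × Point (nE G))
  edgePart e =
    if lookup A e
    then (if twist G e
          then ((e , 0F , 1F) , (e , 1F , 1F)) ∷ ((e , 0F , 0F) , (e , 1F , 0F)) ∷ []
          else ((e , 0F , 1F) , (e , 1F , 0F)) ∷ ((e , 0F , 0F) , (e , 1F , 1F)) ∷ [])
    else []

bdry : (G : CRG) → Subset (nE G) → ℕ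
bdry G A =
  components (nE G * 4) (map (λ pq → enc (proj₁ pq) , enc (proj₂ pq)) (boundaryEdges G A))
  + isolatedCount G

twoRho : (G : CRG) → Subset (nE G) → ℤ
twoRho G A = + (∣ A ∣ + nV G) - + bdry G A

-- edges of A in G/𝒱 (graph on vertex colour classes)
edgesV : (G : CRG) → Subset (nE G) → List (Fin (kV G) × Fin (kV G))
edgesV G A = concatMap (λ e → if lookup A e
                                then (vcol G (vert G e 0F) , vcol G (vert G e 1F)) ∷ []
                                else []) (allFin (nE G))

-- edges of A in G*/ℬ (graph on boundary colour classes); the two sides
-- of e contain the boundary points (e , 0 , 0) and (e , 0 , 1)
edgesB : (G : CRG) → Subset (nE G) → List (Fin (kB G) × Fin (kB G))
edgesB G A = concatMap (λ e → if lookup A e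
                                then (bcol G (inj₂ (e , 0F , 0F)) , bcol G (inj₂ (e , 0F , 1F))) ∷ []
                                else []) (allFin (nE G))

rV : (G : CRG) → Subset (nE G) → ℕ
rV G A = rank (kV G) (edgesV G A)

rB : (G : CRG) → Subset (nE G) → ℕ
rB G A = rank (kB G) (edgesB G A)

-- A monomial  b_bs^a b_bp^(b/2) b_olc^c b_olh^(d/2)  is recorded as (a , b , c , d)
-- (exponents of b_bp and b_olh are doubled, since they may be half-integers).
Monomial : Set
Monomial = ℤ × ℤ × ℤ × ℤ

_≟M_ : (m m' : Monomial) → Dec (m ≡ m')
_≟M_ = ≡-dec ℤP._≟_ (≡-dec ℤP._≟_ (≡-dec ℤP._≟_ ℤP._≟_))

-- (r1(A) , 2 r2(A) , r3(A) , 2 r4(A))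
monomial : (G : CRG) → Subset (nE G) → Monomial
monomial G A =
  r1 ,
  twoRho G A - (+ 2 *ℤ r1) ,
  (+ rB G fullSet - + rB G (∁ A)) ,
  (+ 2 *ℤ (+ ∣ A ∣ +ℤ + rB G (∁ A) - + rB G fullSet) - twoRho G A)
  where r1 = + rV G A

allSubsets : (n : ℕ) → List (Subset n)
allSubsets zero    = [] ∷ []
allSubsets (suc n) = map (true ∷_) (allSubsets n) ++ map (false ∷_) (allSubsets n)

-- The polynomial P(G), given by its coefficients: the coefficient of a
-- monomial m is the number of A ⊆ E contributing m.
coeffP : CRG → Monomial → ℕ
coeffP G m = length (filter (λ A → monomial G A ≟M m) (allSubsets (nE G)))

record WF (G : CRG) : Set where
  field
    prev       : HalfEdge (nE G) → HalfEdge (nE G)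
    prev-next  : ∀ h → prev (next G h) ≡ h
    next-prev  : ∀ h → next G (prev h) ≡ h
    next-vert  : ∀ h → vert G (proj₁ (next G h)) (proj₂ (next G h)) ≡ vert G (proj₁ h) (proj₂ h)
    one-cycle  : ∀ h h' → vert G (proj₁ h) (proj₂ h) ≡ vert G (proj₁ h') (proj₂ h')
                 → Σ ℕ λ k → iter (next G) k h ≡ h'
    bcol-const : ∀ p q → (p , q) ∈ boundaryEdges G fullSet → bcol G (inj₂ p) ≡ bcol G (inj₂ q)

module _ (G G' : CRG) where
  private
    n = nE G
    n' = nE G'

  injH : HalfEdge n → HalfEdge (n + n')
  injH (e , i) = (e ↑ˡ n' , i)

  injH' : HalfEdge n' → HalfEdge (n + n')
  injH' (e , i) = (n ↑ʳ e , i)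

  nextU : HalfEdge (n + n') → HalfEdge (n + n')
  nextU (e , i) with splitAt n e
  ... | inj₁ f = injH (next G (f , i))
  ... | inj₂ f = injH' (next G' (f , i))

  twistU : Fin (n + n') → Bool
  twistU e with splitAt n e
  ... | inj₁ f = twist G f
  ... | inj₂ f = twist G' f

_⊔_ : CRG → CRG → CRG
G ⊔ G' = record
  { nV    = nV G + nV G'
  ; nE    = nE G + nE G'
  ; vert  = vertU
  ; next  = nextU G G'
  ; twist = twistU G G'
  ; kV    = kV G + kV G'
  ; vcol  = vcolU
  ; kB    = kB G + kB G'
  ; bcol  = bcolU
  }
  where
  vertU : Fin (nE G + nE G') → Fin 2 → Fin (nV G + nV G')
  vertU e i with splitAt (nE G) e
  ... | inj₁ f = vert G f i ↑ˡ nV G'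
  ... | inj₂ f = nV G ↑ʳ vert G' f i
  vcolU : Fin (nV G + nV G') → Fin (kV G + kV G')
  vcolU v with splitAt (nV G) v
  ... | inj₁ w = vcol G w ↑ˡ kV G'
  ... | inj₂ w = kV G ↑ʳ vcol G' w
  bcolU : Fin (nV G + nV G') ⊎ Point (nE G + nE G') → Fin (kB G + kB G')
  bcolU (inj₁ v) with splitAt (nV G) v
  ... | inj₁ w = bcol G (inj₁ w) ↑ˡ kB G'
  ... | inj₂ w = kB G ↑ʳ bcol G' (inj₁ w)
  bcolU (inj₂ (e , i , j)) with splitAt (nE G) e
  ... | inj₁ f = bcol G (inj₂ (f , i , j)) ↑ˡ kB G'
  ... | inj₂ f = kB G ↑ʳ bcol G' (inj₂ (f , i , j))

-- Where the arc of a join lies: on the boundary of an isolated vertex,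
-- or on the vertex-boundary arc (corner) following half-edge h, i.e.
-- between h and next h in the vertex orientation.
data Site (G : CRG) : Set where
  isoSite    : Fin (nV G) → Site G
  cornerSite : HalfEdge (nE G) → Site G

ValidSite : (G : CRG) → Site G → Set
ValidSite G (isoSite v)    = IsolatedV G v
ValidSite G (cornerSite h) = ⊤

siteVertex : (G : CRG) → Site G → Fin (nV G)
siteVertex G (isoSite v)          = v
siteVertex G (cornerSite (e , i)) = vert G e i

siteBColour : (G : CRG) → Site G → Fin (kB G)
siteBColour G (isoSite v)          = bcol G (inj₁ v)
siteBColour G (cornerSite (e , i)) = bcol G (inj₂ (e , i , 1F))

remove : ∀ {n} (v x : Fin n) → x ≢ v → Fin (pred n)
remove {suc n} v x ne = punchOut {i = v} {j = x} (λ eq → ne (sym eq))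

insert : ∀ {n} → Fin n → Fin (pred n) → Fin n
insert {suc n} v y = punchIn v y

-- The join of G and G' at the given sites: the vertex v' of G' is
-- identified with the vertex v of G (the vertices of G' other than v'
-- are renumbered after those of G); at the merged vertex the cyclic
-- order of G' is spliced into the corner of G (the orientation of v'
-- is the one stored in G'; the other gluing is the join of G with the
-- representation of G' whose local orientation at v' is reversed);
-- the vertex colour classes of v and v' are merged, and the boundary
-- colour classes of the two boundary components containing the arcs
-- are merged.
join : (G G' : CRG) → Site G → Site G' → CRG
join G G' s s' = record
  { nV    = nV G + pred (nV G')
  ; nE    = nE G + nE G'
  ; vert  = vertJ
  ; next  = nextJ
  ; twist = twistU G G'
  ; kV    = kV G + kV G'
  ; vcol  = vcolJ
  ; kB    = kB G + kB G'
  ; bcol  = bcolJ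
  }
  where
  v  = siteVertex G s
  v' = siteVertex G' s'
  mapV' : Fin (nV G') → Fin (nV G + pred (nV G'))
  mapV' w with w ≟ v'
  ... | yes _ = v ↑ˡ pred (nV G')
  ... | no ne = nV G ↑ʳ remove v' w ne
  vertJ : Fin (nE G + nE G') → Fin 2 → Fin (nV G + pred (nV G'))
  vertJ e i with splitAt (nE G) e
  ... | inj₁ f = vert G f i ↑ˡ pred (nV G')
  ... | inj₂ f = mapV' (vert G' f i)
  splice : Site G → Site G' → HalfEdge (nE G + nE G') → HalfEdge (nE G + nE G')
  splice (cornerSite h₀) (cornerSite h₀') h =
    if ⌊ h ≟h injH G G' h₀ ⌋ then injH' G G' (next G' h₀')
    else if ⌊ h ≟h injH' G G' h₀' ⌋ then injH G G' (next G h₀)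
    else nextU G G' h
  splice _ _ h = nextU G G' h
  nextJ : HalfEdge (nE G + nE G') → HalfEdge (nE G + nE G')
  nextJ = splice s s'
  recolV : Fin (kV G') → Fin (kV G + kV G')
  recolV c = if ⌊ c ≟ vcol G' v' ⌋ then vcol G v ↑ˡ kV G' else kV G ↑ʳ c
  vcolJ : Fin (nV G + pred (nV G')) → Fin (kV G + kV G')
  vcolJ x with splitAt (nV G) x
  ... | inj₁ w = vcol G w ↑ˡ kV G'
  ... | inj₂ y = recolV (vcol G' (insert v' y))
  cB  = siteBColour G s
  cB' = siteBColour G' s'
  recolB : Fin (kB G') → Fin (kB G + kB G')
  recolB c = if ⌊ c ≟ cB' ⌋ then cB ↑ˡ kB G' else kB G ↑ʳ c
  bcolJ : Fin (nV G + pred (nV G')) ⊎ Point (nE G + nE G') → Fin (kB G + kB G')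
  bcolJ (inj₁ x) with splitAt (nV G) x
  ... | inj₁ w = bcol G (inj₁ w) ↑ˡ kB G'
  ... | inj₂ y = recolB (bcol G' (inj₁ (insert v' y)))
  bcolJ (inj₂ (e , i , j)) with splitAt (nE G) e
  ... | inj₁ f = bcol G (inj₂ (f , i , j)) ↑ˡ kB G'
  ... | inj₂ f = recolB (bcol G' (inj₂ (f , i , j)))

-- The monomial of A ⊆ E only involves |A|, |V| - b(A), and the ranks of A and E ∖ A in the
-- graphs G/𝒱 and G*/ℬ. Joining two vertices v, v′ identifies one vertex of G/𝒱 (the class of v′)
-- with another (the class of v); as no edge of the disjoint union joins G to G′, these lie in
-- different components, so the identification does not change the number of components, and the
-- same holds in G*/ℬ. So the ranks agree, and it remains to see that b(A) drops by one, like |V|.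
-- If a site is an isolated vertex, its boundary circle disappears. If both sites are corners,
-- the boundary graph of the join is that of the union with the arcs p–q (in G) and r–s (in G′)
-- exchanged for p–s and r–q. The boundary component of G′ through r–s is a cycle, so s and r
-- stay connected after the exchange, and the components of p and r merge into one.

module Submission where

open import Defs
open import Data.Nat using (ℕ; zero; suc; _+_; _*_; _∸_; _≤_; z≤n; s≤s; pred)
open import Data.Nat.Properties
  using (+-assoc; +-comm; +-suc; +-identityʳ; ≤-antisym; n<1+n; m≤n⇒∃[o]m+o≡n; +-commutativeSemigroup)
open import Algebra.Properties.CommutativeSemigroup +-commutativeSemigroup using (x∙yz≈y∙xz; interchange)
open import Data.Nat.Tactic.RingSolver using (solve-∀)
open import Data.Integer as ℤ using (ℤ)
open import Data.Integer.Properties using (m-n≡m⊖n; [1+m]⊖[1+n]≡m⊖n)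
open import Data.Bool using (Bool; true; false; if_then_else_; _∧_; _∨_; not; T)
open import Data.Bool.Properties using (∧-identityʳ; ∧-zeroʳ; ∨-zeroʳ; T-≡; T-∨; ⇔→≡)
open import Data.Fin using (Fin; zero; suc; toℕ; _↑ˡ_; _↑ʳ_; splitAt; punchIn; remQuot; combine; _≟_)
open import Data.Fin.Properties
  using ( suc-injective; pigeonhole; splitAt-↑ˡ; splitAt-↑ʳ; ↑ˡ-injective; ↑ʳ-injective
        ; punchInᵢ≢i; punchIn-punchOut; punchOut-punchIn; punchOut-cong; combine-injective; remQuot-combine)
open import Data.Fin.Subset using (Subset; ∁; ∣_∣) renaming (⊤ to fullSet)
open import Data.Vec using (lookup)
open import Data.List using (List; []; _∷_; _++_; [_]; map; concatMap; foldl; filter; length; tabulate; allFin)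
open import Data.List.Properties using (foldl-++; ++-assoc; ++-identityʳ; concatMap-cong; map-concatMap; filter-≐)
open import Data.List.Membership.Propositional using (_∈_; lose; find)
open import Data.List.Membership.Propositional.Properties
  using (∈-++⁻; ∈-++⁺ˡ; ∈-++⁺ʳ; ∈-allFin; ∈-map⁺; ∈-map⁻; ∈-concatMap⁺; ∈-concatMap⁻)
open import Data.List.Relation.Unary.Any using (here; there; any?; satisfied)
open import Data.List.Relation.Unary.Any.Properties using (any⁺; any⁻)
open import Data.Product as Product using (Σ; _,_; proj₁; proj₂; _×_)
open import Data.Sum using (_⊎_; inj₁; inj₂; [_,_]′)
open import Data.Empty using (⊥-elim)
open import Function using (_∘_; const; _⇔_; mk⇔; Equivalence)
open import Function.Definitions using (Injective)
open import Level using (0ℓ)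
open import Relation.Binary.Core using (Rel)
open import Relation.Binary.Definitions using (Symmetric; Transitive)
open import Relation.Binary.PropositionalEquality hiding ([_]; J)
open import Relation.Binary.Construct.Closure.Equivalence as EqClosure using (EqClosure)
open import Relation.Binary.Construct.Closure.ReflexiveTransitive using (ε; _◅◅_)
open import Relation.Nullary using (¬_; Dec; yes; no; does)
open import Relation.Nullary.Decidable using (⌊_⌋; isYes≗does; dec-true; dec-false; fromWitness; toWitness)
open import Relation.Unary using (Pred; Decidable)

indicator : Bool → ℕ
indicator true  = 1
indicator false = 0

count : (n : ℕ) → (Fin n → Bool) → ℕ
count zero    p = 0
count (suc n) p = indicator (p zero) + count n (p ∘ suc)

count-cong : ∀ n {p q : Fin n → Bool} → (∀ i → p i ≡ q i) → count n p ≡ count n q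
count-cong zero    p≗q = refl
count-cong (suc n) p≗q = cong₂ _+_ (cong indicator (p≗q zero)) (count-cong n (p≗q ∘ suc))

count-+ : ∀ m n (p : Fin (m + n) → Bool) →
          count (m + n) p ≡ count m (p ∘ (_↑ˡ n)) + count n (p ∘ (m ↑ʳ_))
count-+ zero    n p = refl
count-+ (suc m) n p = trans (cong (indicator (p zero) +_) (count-+ m n (p ∘ suc)))
                            (sym (+-assoc (indicator (p zero)) _ _))

count-punchIn : ∀ n (p : Fin (suc n) → Bool) v →
                count (suc n) p ≡ indicator (p v) + count n (p ∘ punchIn v)
count-punchIn n       p zero    = refl
count-punchIn (suc n) p (suc v) =
  trans (cong (indicator (p zero) +_) (count-punchIn n (p ∘ suc) v))
        (x∙yz≈y∙xz (indicator (p zero)) (indicator (p (suc v))) (count n (p ∘ suc ∘ punchIn v)))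

count-insert : ∀ {n} (p : Fin n → Bool) (v : Fin n) →
               count n p ≡ indicator (p v) + count (pred n) (p ∘ insert v)
count-insert {suc n} p v = count-punchIn n p v

count-erase : ∀ n (p : Fin n → Bool) t → p t ≡ true →
              count n p ≡ suc (count n (λ i → p i ∧ not (does (i ≟ t))))
count-erase (suc n) p zero pt rewrite pt =
  cong suc (count-cong n (λ i → sym (∧-identityʳ (p (suc i)))))
count-erase (suc n) p (suc t) pt =
  trans (cong (indicator (p zero) +_) (count-erase n (p ∘ suc) t pt))
        (trans (+-suc (indicator (p zero)) rest)
               (cong (λ b → suc (indicator b + rest)) (sym (∧-identityʳ (p zero)))))
  where rest = count n (λ i → p (suc i) ∧ not (does (i ≟ t)))

count-≤-injection : ∀ n m (p : Fin n → Bool) (q : Fin m → Bool) (f : Fin n → Fin m) →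
                    (∀ i → p i ≡ true → q (f i) ≡ true) →
                    (∀ i j → p i ≡ true → p j ≡ true → f i ≡ f j → i ≡ j) →
                    count n p ≤ count m q
count-≤-injection zero    m p q f pres inj = z≤n
count-≤-injection (suc n) m p q f pres inj with p zero in p0
... | false =
  count-≤-injection n m (p ∘ suc) q (f ∘ suc) (pres ∘ suc)
    (λ i j pi pj → suc-injective ∘ inj (suc i) (suc j) pi pj)
... | true rewrite count-erase m q (f zero) (pres zero p0) =
  s≤s (count-≤-injection n m (p ∘ suc) _ (f ∘ suc) pres-suc
         (λ i j pi pj → suc-injective ∘ inj (suc i) (suc j) pi pj))
  where
  pres-suc : ∀ i → p (suc i) ≡ true → (q (f (suc i)) ∧ not (does (f (suc i) ≟ f zero))) ≡ true
  pres-suc i pi with f (suc i) ≟ f zero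
  ... | yes eq with () ← inj (suc i) zero pi p0 eq
  ... | no  _  rewrite pres (suc i) pi = refl

length-filter-allFin : ∀ n {P : Pred (Fin n) 0ℓ} (P? : Decidable P) →
                       length (filter P? (allFin n)) ≡ count n (does ∘ P?)
length-filter-allFin n P? = go n (λ i → i)
  where
  go : ∀ k (f : Fin k → Fin n) → length (filter P? (tabulate f)) ≡ count k (does ∘ P? ∘ f)
  go zero    f = refl
  go (suc k) f with does (P? (f zero))
  ... | true  = cong suc (go k (f ∘ suc))
  ... | false = go k (f ∘ suc)

+-indicator-true : ∀ c {b} → b ≡ true → c + indicator b ≡ suc c
+-indicator-true c refl = +-comm c 1

+-indicator-false : ∀ c {b} → b ≡ false → c + indicator b ≡ c
+-indicator-false c refl = +-identityʳ c

indicator-not-∨-∧ : ∀ a b →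
                    indicator (not a) + indicator (not b) ≡ indicator (not (a ∨ b)) + indicator (not (a ∧ b))
indicator-not-∨-∧ true  true  = refl
indicator-not-∨-∧ true  false = refl
indicator-not-∨-∧ false true  = refl
indicator-not-∨-∧ false false = refl

-- Connected components

Adjacent : {A : Set} → List (A × A) → Rel A 0ℓ
Adjacent es x y = (x , y) ∈ es

Connected : {A : Set} → List (A × A) → Rel A 0ℓ
Connected es = EqClosure (Adjacent es)

both : ∀ {A B : Set} → (A → B) → A × A → B × B
both f = Product.map f f

module _ {A : Set} {es : List (A × A)} where

  edge : ∀ {x y} → Adjacent es x y → Connected es x y
  edge = EqClosure.return

  reverse : ∀ {x y} → Connected es x y → Connected es y x
  reverse = EqClosure.symmetric (Adjacent es)

  connected-invariant : ∀ {B : Set} (f : A → B) → (∀ {x y} → Adjacent es x y → f x ≡ f y) →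
                        ∀ {x y} → Connected es x y → f x ≡ f y
  connected-invariant f = EqClosure.gfold isEquivalence f

  separated⇒¬connected : ∀ {B : Set} (f : A → B) → (∀ {x y} → Adjacent es x y → f x ≡ f y) →
                         ∀ {x y} → f x ≢ f y → ¬ Connected es x y
  separated⇒¬connected f f-resp fx≢fy = fx≢fy ∘ connected-invariant f f-resp

connected-⊆ : ∀ {A : Set} {es fs : List (A × A)} → (∀ {x y} → Adjacent es x y → Connected fs x y) →
              ∀ {x y} → Connected es x y → Connected fs x y
connected-⊆ h = EqClosure.fold (EqClosure.isEquivalence _) h

connected-map : ∀ {A B : Set} (f : A → B) {es : List (A × A)} {x y} →
                Connected es x y → Connected (map (both f) es) (f x) (f y)
connected-map f = EqClosure.gmap f (∈-map⁺ (both f))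

∈-map-cases : ∀ {A B : Set} (f : A → B) {xs ys : List A} {u w} →
              (∀ {e} → e ∈ xs → e ∈ ys ⊎ (e ≡ u ⊎ e ≡ w)) →
              ∀ {e} → e ∈ map f xs → e ∈ map f ys ⊎ (e ≡ f u ⊎ e ≡ f w)
∈-map-cases f cases e∈ with ∈-map⁻ f e∈
... | x , x∈xs , refl with cases x∈xs
...   | inj₁ x∈ys        = inj₁ (∈-map⁺ f x∈ys)
...   | inj₂ (inj₁ refl) = inj₂ (inj₁ refl)
...   | inj₂ (inj₂ refl) = inj₂ (inj₂ refl)

module _ {n : ℕ} where

  Graph : Set
  Graph = List (Fin n × Fin n)

  record Labelling (es : Graph) (l : Fin n → Fin n) : Set where
    field
      reaches  : ∀ x → Connected es x (l x)
      respects : ∀ {x y} → Adjacent es x y → l x ≡ l y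

    label-cong : ∀ {x y} → Connected es x y → l x ≡ l y
    label-cong = connected-invariant l respects

    label-idem : ∀ x → l (l x) ≡ l x
    label-idem x = label-cong (reverse (reaches x))

    same-label⇒connected : ∀ {x y} → l x ≡ l y → Connected es x y
    same-label⇒connected {x} {y} lx≡ly =
      reaches x ◅◅ subst (Connected es (l x)) lx≡ly ε ◅◅ reverse (reaches y)

  open Labelling

  relabel-labelling : ∀ {es l} u v → Labelling es l → Labelling (es ++ [ (u , v) ]) (relabel l (u , v))
  relabel-labelling {es} {l} u v L = record { reaches = reaches′ ; respects = respects′ }
    where
    es′ = es ++ [ (u , v) ]
    old : ∀ {x y} → Connected es x y → Connected es′ x y
    old = connected-⊆ (edge ∘ ∈-++⁺ˡ)
    uv : Connected es′ u v
    uv = edge (∈-++⁺ʳ es (here refl))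
    reaches′ : ∀ x → Connected es′ x (relabel l (u , v) x)
    reaches′ x with l x ≟ l v
    ... | yes lx≡lv = old (same-label⇒connected L lx≡lv) ◅◅ reverse uv ◅◅ old (reaches L u)
    ... | no  _     = old (reaches L x)
    respects′ : ∀ {x y} → Adjacent es′ x y → relabel l (u , v) x ≡ relabel l (u , v) y
    respects′ {x} {y} xy with ∈-++⁻ es xy
    ... | inj₁ xy∈es rewrite respects L xy∈es = refl
    ... | inj₂ (here refl) with l y ≟ l y | l x ≟ l y
    ...   | no ly≢ly | _ = ⊥-elim (ly≢ly refl)
    ...   | yes _    | yes _ = refl
    ...   | yes _    | no  _ = refl

  foldl-relabel-labelling : ∀ {es l} fs → Labelling es l → Labelling (es ++ fs) (foldl relabel l fs)
  foldl-relabel-labelling {es} []       L = subst (λ gs → Labelling gs _) (sym (++-identityʳ es)) L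
  foldl-relabel-labelling {es} (f ∷ fs) L =
    subst (λ gs → Labelling gs _) (++-assoc es [ f ] fs)
      (foldl-relabel-labelling fs (relabel-labelling (proj₁ f) (proj₂ f) L))

  labels-labelling : ∀ es → Labelling es (labels es)
  labels-labelling es = foldl-relabel-labelling es
    (record { reaches = λ _ → ε ; respects = λ () })

  inImage : (Fin n → Fin n) → Fin n → Bool
  inImage l y = does (any? (λ x → l x ≟ y) (allFin n))

  inImage-intro : ∀ l x {y} → l x ≡ y → inImage l y ≡ true
  inImage-intro l x {y} lx≡y = dec-true (any? (λ z → l z ≟ y) (allFin n)) (lose (∈-allFin x) lx≡y)

  inImage-elim : ∀ l y → inImage l y ≡ true → Σ (Fin n) λ x → l x ≡ y
  inImage-elim l y _ with any? (λ x → l x ≟ y) (allFin n)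
  ... | yes ∃x = satisfied ∃x

  components≡count : ∀ es → components n es ≡ count n (inImage (labels es))
  components≡count es = length-filter-allFin n _

  label-fixed : ∀ {es l} → Labelling es l → ∀ y → inImage l y ≡ true → l y ≡ y
  label-fixed L y y∈img with inImage-elim _ y y∈img
  ... | x , refl = label-idem L x

  components-≤ : ∀ {es fs : Graph} → (∀ {x y} → Adjacent fs x y → Connected es x y) →
                 components n es ≤ components n fs
  components-≤ {es} {fs} fs⊆es
    rewrite components≡count es | components≡count fs =
    count-≤-injection n n _ _ (labels fs) (λ x _ → inImage-intro (labels fs) x refl) injective
    where
    Les = labels-labelling es
    Lfs = labels-labelling fs
    injective : ∀ i j → inImage (labels es) i ≡ true → inImage (labels es) j ≡ true →
                labels fs i ≡ labels fs j → i ≡ j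
    injective i j i∈img j∈img eq = begin
      i             ≡⟨ sym (label-fixed Les i i∈img) ⟩
      labels es i   ≡⟨ label-cong Les (connected-⊆ fs⊆es (same-label⇒connected Lfs eq)) ⟩
      labels es j   ≡⟨ label-fixed Les j j∈img ⟩
      j             ∎
      where open ≡-Reasoning

  components-cong : ∀ {es fs : Graph} → (∀ {x y} → Adjacent es x y → Connected fs x y) →
                    (∀ {x y} → Adjacent fs x y → Connected es x y) → components n es ≡ components n fs
  components-cong es⊆fs fs⊆es = ≤-antisym (components-≤ fs⊆es) (components-≤ es⊆fs)

  relabel-unchanged : ∀ {l : Fin n → Fin n} {u v x} → l x ≢ l v → relabel l (u , v) x ≡ l x
  relabel-unchanged {l} {u} {v} {x} lx≢lv with l x ≟ l v
  ... | yes lx≡lv = ⊥-elim (lx≢lv lx≡lv)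
  ... | no  _     = refl

  components-add-bridge : ∀ es {u v} → ¬ Connected es u v →
                          components n es ≡ suc (components n (es ++ [ (u , v) ]))
  components-add-bridge es {u} {v} ¬u~v
    rewrite components≡count es | components≡count (es ++ [ (u , v) ])
          | foldl-++ relabel (λ x → x) es [ (u , v) ] =
    trans (count-erase n (inImage l) (l v) (inImage-intro l v refl)) (cong suc (count-cong n erased))
    where
    l = labels es
    L = labels-labelling es
    l′ = relabel l (u , v)
    lu≢lv : l u ≢ l v
    lu≢lv = ¬u~v ∘ same-label⇒connected L
    kept : ∀ z → l z ≢ l v → (inImage l (l z) ∧ not (does (l z ≟ l v))) ≡ true
    kept z lz≢lv rewrite inImage-intro l z refl | dec-false (l z ≟ l v) lz≢lv = refl
    erased : ∀ y → (inImage l y ∧ not (does (y ≟ l v))) ≡ inImage l′ y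
    erased y = ⇔→≡ {z = true} (mk⇔ to from)
      where
      to : (inImage l y ∧ not (does (y ≟ l v))) ≡ true → inImage l′ y ≡ true
      to h with inImage l y in y∈img | y ≟ l v
      to () | false | _
      to () | true  | yes _
      ... | true | no y≢lv with inImage-elim l y y∈img
      ...   | x , lx≡y =
        inImage-intro l′ x (trans (relabel-unchanged {l = l} {u} {v} (y≢lv ∘ trans (sym lx≡y))) lx≡y)
      from : inImage l′ y ≡ true → (inImage l y ∧ not (does (y ≟ l v))) ≡ true
      from h with inImage-elim l′ y h
      ... | x , refl with l x ≟ l v
      ...   | yes _     = kept u lu≢lv
      ...   | no  lx≢lv = kept x lx≢lv

  merge : Fin n → Fin n → Fin n → Fin n
  merge a b x = if does (x ≟ a) then b else x

  mergeEdges : Fin n → Fin n → Graph → Graph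
  mergeEdges a b = map (both (merge a b))

  -- After merging, a is isolated; adding the edge a–b to either graph gives the same connectivity.
  components-mergeEdges : ∀ es {a b} → ¬ Connected es a b →
                          components n (mergeEdges a b es) ≡ components n es
  components-mergeEdges es {a} {b} ¬a~b = begin
    components n ms                    ≡⟨ components-add-bridge ms ¬a~b′ ⟩
    suc (components n (ms ++ [ ab ]))  ≡⟨ cong suc (components-cong ms⊆es es⊆ms) ⟩
    suc (components n (es ++ [ ab ]))  ≡⟨ sym (components-add-bridge es ¬a~b) ⟩
    components n es                    ∎
    where
    open ≡-Reasoning
    ab = (a , b)
    ms = mergeEdges a b es
    a≢b : a ≢ b
    a≢b refl = ¬a~b ε
    merged≢a : ∀ x → merge a b x ≢ a
    merged≢a x with x ≟ a
    ... | yes _   = a≢b ∘ sym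
    ... | no  x≢a = x≢a
    ¬a~b′ : ¬ Connected ms a b
    ¬a~b′ = separated⇒¬connected (λ x → does (x ≟ a)) same-side a-vs-b
      where
      same-side : ∀ {x y} → Adjacent ms x y → does (x ≟ a) ≡ does (y ≟ a)
      same-side xy with (x , y) , _ , refl ← ∈-map⁻ _ xy =
        trans (dec-false (merge a b x ≟ a) (merged≢a x)) (sym (dec-false (merge a b y ≟ a) (merged≢a y)))
      a-vs-b : does (a ≟ a) ≢ does (b ≟ a)
      a-vs-b eq with () ← trans (sym (dec-true (a ≟ a) refl)) (trans eq (dec-false (b ≟ a) (a≢b ∘ sym)))
    to-merged : ∀ {gs} → Adjacent gs a b → ∀ x → Connected gs x (merge a b x)
    to-merged ab∈gs x with x ≟ a
    ... | yes refl = edge ab∈gs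
    ... | no  _    = ε
    ms⊆es : ∀ {x y} → Adjacent (ms ++ [ ab ]) x y → Connected (es ++ [ ab ]) x y
    ms⊆es xy with ∈-++⁻ ms xy
    ... | inj₂ (here refl) = edge (∈-++⁺ʳ es (here refl))
    ... | inj₁ xy∈ms with ∈-map⁻ _ xy∈ms
    ...   | (x , y) , xy∈es , refl =
      reverse (to-merged ab∈es x) ◅◅ edge (∈-++⁺ˡ xy∈es) ◅◅ to-merged ab∈es y
      where ab∈es = ∈-++⁺ʳ es (here refl)
    es⊆ms : ∀ {x y} → Adjacent (es ++ [ ab ]) x y → Connected (ms ++ [ ab ]) x y
    es⊆ms {x} {y} xy with ∈-++⁻ es xy
    ... | inj₂ (here refl) = edge (∈-++⁺ʳ ms (here refl))
    ... | inj₁ xy∈es =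
      to-merged ab∈ms x ◅◅ edge (∈-++⁺ˡ (∈-map⁺ _ xy∈es)) ◅◅ reverse (to-merged ab∈ms y)
      where ab∈ms = ∈-++⁺ʳ ms (here refl)

  rank-mergeEdges : ∀ es {a b} → ¬ Connected es a b → rank n (mergeEdges a b es) ≡ rank n es
  rank-mergeEdges es ¬a~b = cong (n ∸_) (components-mergeEdges es ¬a~b)

  components-switch :
    ∀ {es fs : Graph} {p q r s} →
    (∀ {e} → e ∈ es → e ∈ fs ⊎ (e ≡ (p , q) ⊎ e ≡ (r , s))) →
    (∀ {e} → e ∈ fs → e ∈ es ⊎ (e ≡ (p , s) ⊎ e ≡ (r , q))) →
    (p , q) ∈ es → (r , s) ∈ es → (p , s) ∈ fs → (r , q) ∈ fs →
    Connected fs s r → ¬ Connected es p r →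
    components n es ≡ suc (components n fs)
  components-switch {es} {fs} {p} {q} {r} {s} es⊆ fs⊆ pq rs ps rq s~r ¬p~r =
    trans (components-add-bridge es ¬p~r) (cong suc (components-cong es′⊆fs fs⊆es′))
    where
    es′ = es ++ [ (p , r) ]
    pr′ : Connected es′ p r
    pr′ = edge (∈-++⁺ʳ es (here refl))
    old : ∀ {x y} → (x , y) ∈ es → Connected es′ x y
    old = edge ∘ ∈-++⁺ˡ
    es′⊆fs : ∀ {x y} → Adjacent es′ x y → Connected fs x y
    es′⊆fs xy with ∈-++⁻ es xy
    ... | inj₂ (here refl) = edge ps ◅◅ s~r
    ... | inj₁ xy∈es with es⊆ xy∈es
    ...   | inj₁ xy∈fs       = edge xy∈fs
    ...   | inj₂ (inj₁ refl) = edge ps ◅◅ s~r ◅◅ edge rq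
    ...   | inj₂ (inj₂ refl) = reverse s~r
    fs⊆es′ : ∀ {x y} → Adjacent fs x y → Connected es′ x y
    fs⊆es′ xy with fs⊆ xy
    ... | inj₁ xy∈es       = old xy∈es
    ... | inj₂ (inj₁ refl) = pr′ ◅◅ old rs
    ... | inj₂ (inj₂ refl) = reverse pr′ ◅◅ old pq

-- edgesV G A and edgesB G A are definitionally selectedEdges A, with the ends of e coloured
-- by vcol ∘ vert and by the boundary colours of the two sides of e.
selectedEdges : ∀ {m k} → Subset m → (Fin m → Fin 2 → Fin k) → List (Fin k × Fin k)
selectedEdges {m} A end =
  concatMap (λ e → if lookup A e then [ (end e 0F , end e 1F) ] else []) (allFin m)

module _ {m k : ℕ} (A : Subset m) where

  ∈-selectedEdges⁻ : ∀ {end : Fin m → Fin 2 → Fin k} {x y} → (x , y) ∈ selectedEdges A end →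
                     Σ (Fin m) λ e → x ≡ end e 0F × y ≡ end e 1F
  ∈-selectedEdges⁻ {end} xy∈ with e , _ , xy∈e ← find (∈-concatMap⁻ _ {xs = allFin m} xy∈)
                             with lookup A e | xy∈e
  ... | true | here refl = e , refl , refl

  selectedEdges-merge : ∀ (end end′ : Fin m → Fin 2 → Fin k) {a b} →
                        (∀ e i → end′ e i ≡ merge a b (end e i)) →
                        selectedEdges A end′ ≡ mergeEdges a b (selectedEdges A end)
  selectedEdges-merge end end′ {a} {b} end′≡ =
    trans (concatMap-cong pointwise (allFin m)) (sym (map-concatMap (both (merge a b)) _ (allFin m)))
    where
    pointwise : ∀ e → (if lookup A e then [ (end′ e 0F , end′ e 1F) ] else [])
                      ≡ map (both (merge a b)) (if lookup A e then [ (end e 0F , end e 1F) ] else [])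
    pointwise e with lookup A e
    ... | true  = cong₂ (λ x y → [ (x , y) ]) (end′≡ e 0F) (end′≡ e 1F)
    ... | false = refl

  rank-selectedEdges-merge : ∀ (end end′ : Fin m → Fin 2 → Fin k) {a b} →
                             (∀ e i → end′ e i ≡ merge a b (end e i)) →
                             ∀ {B : Set} (side : Fin k → B) → (∀ e → side (end e 0F) ≡ side (end e 1F)) →
                             side a ≢ side b → rank k (selectedEdges A end′) ≡ rank k (selectedEdges A end)
  rank-selectedEdges-merge end end′ end′≡ side end-side a≢b =
    trans (cong (rank k) (selectedEdges-merge end end′ end′≡))
          (rank-mergeEdges _ (separated⇒¬connected side same-side a≢b))
    where
    same-side : ∀ {x y} → Adjacent (selectedEdges A end) x y → side x ≡ side y
    same-side xy with e , refl , refl ← ∈-selectedEdges⁻ {end} xy = end-side e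

-- Alternating walks of two involutions

module _ {A : Set} (f : A → A) where

  iter-+ : ∀ m n x → iter f (m + n) x ≡ iter f m (iter f n x)
  iter-+ zero    n x = refl
  iter-+ (suc m) n x = cong f (iter-+ m n x)

  iter-suc : ∀ n x → iter f (suc n) x ≡ iter f n (f x)
  iter-suc zero    x = refl
  iter-suc (suc n) x = cong f (iter-suc n x)

  iter-injective : Injective _≡_ _≡_ f → ∀ n → Injective _≡_ _≡_ (iter f n)
  iter-injective f-inj zero    eq = eq
  iter-injective f-inj (suc n) eq = iter-injective f-inj n (f-inj eq)

even-or-odd : ∀ i → Σ ℕ λ t → i ≡ t + t ⊎ i ≡ suc (t + t)
even-or-odd zero = zero , inj₁ refl
even-or-odd (suc i) with even-or-odd i
... | t , inj₁ refl = t , inj₂ refl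
... | t , inj₂ refl = suc t , inj₁ (cong suc (sym (+-suc t t)))

orbit-returns : ∀ {P : Set} {M} (code : P → Fin M) → Injective _≡_ _≡_ code →
                (ψ : P → P) → Injective _≡_ _≡_ ψ → ∀ x → Σ ℕ λ k → iter ψ (suc k) x ≡ x
orbit-returns {M = M} code code-inj ψ ψ-inj x
  with i , j , i<j , same-code ← pigeonhole (n<1+n M) (λ i → code (iter ψ (toℕ i) x))
  with d , i+1+d≡j ← m≤n⇒∃[o]m+o≡n i<j =
  d , iter-injective ψ ψ-inj (toℕ i) (begin
    iter ψ (toℕ i) (iter ψ (suc d) x)  ≡⟨ sym (iter-+ ψ (toℕ i) (suc d) x) ⟩
    iter ψ (toℕ i + suc d) x           ≡⟨ cong (λ m → iter ψ m x) (trans (+-suc (toℕ i) d) i+1+d≡j) ⟩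
    iter ψ (toℕ j) x                   ≡⟨ sym (code-inj same-code) ⟩
    iter ψ (toℕ i) x                   ∎)
  where open ≡-Reasoning

module _ {P : Set} {M : ℕ} (code : P → Fin M) (code-inj : Injective _≡_ _≡_ code)
         (α β : P → P) (α-invol : ∀ x → α (α x) ≡ x) (β-invol : ∀ x → β (β x) ≡ x)
         (α-fpf : ∀ x → α x ≢ x) (β-fpf : ∀ x → β x ≢ x) where

  private
    ψ : P → P
    ψ = β ∘ α

    involution-injective : ∀ (g : P → P) → (∀ x → g (g x) ≡ x) → Injective _≡_ _≡_ g
    involution-injective g g-invol {x} {y} eq = trans (sym (g-invol x)) (trans (cong g eq) (g-invol y))

    ψ-inj : Injective _≡_ _≡_ ψ
    ψ-inj = involution-injective α α-invol ∘ involution-injective β β-invol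

    α-conj : ∀ n x → iter ψ n (α (iter ψ n x)) ≡ α x
    α-conj zero    x = refl
    α-conj (suc n) x = begin
      iter ψ (suc n) (α (ψ y))  ≡⟨ iter-suc ψ n _ ⟩
      iter ψ n (ψ (α (ψ y)))    ≡⟨ cong (iter ψ n) (trans (cong β (α-invol (β (α y)))) (β-invol (α y))) ⟩
      iter ψ n (α y)            ≡⟨ α-conj n x ⟩
      α x                       ∎
      where
      open ≡-Reasoning
      y = iter ψ n x

    orbit-avoids-α : ∀ r i → iter ψ i r ≢ α r
    orbit-avoids-α r i eq with even-or-odd i
    ... | t , inj₁ refl =
      α-fpf y (sym (iter-injective ψ ψ-inj t (trans (sym (iter-+ ψ t t r)) (trans eq (sym (α-conj t r))))))
      where y = iter ψ t r
    ... | t , inj₂ refl =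
      β-fpf (α y) (iter-injective ψ ψ-inj t
        (trans (sym (iter-suc ψ t y)) (trans (cong ψ (sym (iter-+ ψ t t r))) (trans eq (sym (α-conj t r))))))
      where y = iter ψ t r

  -- The edges x–α x and x–β x form alternating cycles. The orbit of r under ψ = β ∘ α returns to r
  -- and, by the parity argument of orbit-avoids-α, never meets α r; so the walk α r, ψ r, ψ² r, …
  -- reaches r without using the edge r–α r.
  α-edge-bypass : ∀ {ℓ} (R : Rel P ℓ) → Transitive R → ∀ r →
                  (∀ x → R x (β x)) → (∀ x → x ≢ r → x ≢ α r → R x (α x)) → R (α r) r
  α-edge-bypass R R-trans r Rβ Rα with k , ψᵏ⁺¹r≡r ← orbit-returns code code-inj ψ ψ-inj r
    with walk k
    where
    walk : ∀ k → R (α r) (iter ψ (suc k) r) ⊎ R (α r) r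
    walk zero = inj₁ (Rβ (α r))
    walk (suc k) with walk k
    ... | inj₂ done = inj₂ done
    ... | inj₁ reach with code (iter ψ (suc k) r) ≟ code r
    ...   | yes same = inj₂ (subst (R (α r)) (code-inj same) reach)
    ...   | no  diff = inj₁ (R-trans reach (R-trans (Rα _ (diff ∘ cong code) (orbit-avoids-α r (suc k))) (Rβ _)))
  ... | inj₁ reach = subst (R (α r)) ψᵏ⁺¹r≡r reach
  ... | inj₂ done  = done

-- The boundary of a ribbon graph

module _ {n : ℕ} where

  endpoint : HalfEdge n → Fin 2 → Point n
  endpoint h j = proj₁ h , proj₂ h , j

  arc : (HalfEdge n → HalfEdge n) → HalfEdge n → Point n × Point n
  arc nxt h = endpoint h 1F , endpoint (nxt h) 0F

  attachment : (Fin n → Bool) → HalfEdge n → List (Point n × Point n)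
  attachment sel h = if sel (proj₁ h) then [] else [ (endpoint h 0F , endpoint h 1F) ]

  ribbonSides : Bool → Bool → Fin n → List (Point n × Point n)
  ribbonSides t s e =
    if s
    then (if t
          then ((e , 0F , 1F) , (e , 1F , 1F)) ∷ ((e , 0F , 0F) , (e , 1F , 0F)) ∷ []
          else ((e , 0F , 1F) , (e , 1F , 0F)) ∷ ((e , 0F , 0F) , (e , 1F , 1F)) ∷ [])
    else []

  halfEdgePart : (HalfEdge n → HalfEdge n) → (Fin n → Bool) → HalfEdge n → List (Point n × Point n)
  halfEdgePart nxt sel h = arc nxt h ∷ attachment sel h

  -- boundaryEdges G A is definitionally boundaryGraph (next G) (twist G) (lookup A).
  boundaryGraph : (HalfEdge n → HalfEdge n) → (Fin n → Bool) → (Fin n → Bool) → List (Point n × Point n)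
  boundaryGraph nxt tw sel =
    concatMap (halfEdgePart nxt sel) (allHalfEdges n)
    ++ concatMap (λ e → ribbonSides (tw e) (sel e) e) (allFin n)

  arc-≡ : ∀ {nxt : HalfEdge n → HalfEdge n} h {k} → nxt h ≡ k → arc nxt h ≡ (endpoint h 1F , endpoint k 0F)
  arc-≡ h refl = refl

  segments : (Fin n → Bool) → (Fin n → Bool) → List (Point n × Point n)
  segments tw sel =
    concatMap (attachment sel) (allHalfEdges n) ++ concatMap (λ e → ribbonSides (tw e) (sel e) e) (allFin n)

  ∈-allHalfEdges : ∀ h → h ∈ allHalfEdges n
  ∈-allHalfEdges (e , 0F) = ∈-concatMap⁺ (λ e → (e , 0F) ∷ (e , 1F) ∷ []) (lose (∈-allFin e) (here refl))
  ∈-allHalfEdges (e , 1F) = ∈-concatMap⁺ (λ e → (e , 0F) ∷ (e , 1F) ∷ []) (lose (∈-allFin e) (there (here refl)))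

  module _ {nxt : HalfEdge n → HalfEdge n} {tw sel : Fin n → Bool} where

    arc∈boundaryGraph : ∀ h {k} → nxt h ≡ k → (endpoint h 1F , endpoint k 0F) ∈ boundaryGraph nxt tw sel
    arc∈boundaryGraph h refl = ∈-++⁺ˡ (∈-concatMap⁺ (halfEdgePart nxt sel) (lose (∈-allHalfEdges h) (here refl)))

    segment∈boundaryGraph : ∀ {x} → x ∈ segments tw sel → x ∈ boundaryGraph nxt tw sel
    segment∈boundaryGraph x∈ with ∈-++⁻ (concatMap (attachment sel) (allHalfEdges n)) x∈
    ... | inj₂ x∈sides = ∈-++⁺ʳ (concatMap (halfEdgePart nxt sel) (allHalfEdges n)) x∈sides
    ... | inj₁ x∈att with h , h∈ , x∈h ← find (∈-concatMap⁻ (attachment sel) {xs = allHalfEdges n} x∈att) =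
      ∈-++⁺ˡ (∈-concatMap⁺ (halfEdgePart nxt sel) (lose h∈ (there x∈h)))

    ∈-boundaryGraph⁻ : ∀ {x} → x ∈ boundaryGraph nxt tw sel →
                       (Σ (HalfEdge n) λ h → x ≡ arc nxt h) ⊎ x ∈ segments tw sel
    ∈-boundaryGraph⁻ x∈ with ∈-++⁻ (concatMap (halfEdgePart nxt sel) (allHalfEdges n)) x∈
    ... | inj₂ x∈sides = inj₂ (∈-++⁺ʳ (concatMap (attachment sel) (allHalfEdges n)) x∈sides)
    ... | inj₁ x∈hs with find (∈-concatMap⁻ (halfEdgePart nxt sel) {xs = allHalfEdges n} x∈hs)
    ...   | h , _  , here x≡arc = inj₁ (h , x≡arc)
    ...   | h , h∈ , there x∈h  = inj₂ (∈-++⁺ˡ (∈-concatMap⁺ (attachment sel) (lose h∈ x∈h)))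

  attachment∈segments : ∀ {tw sel} h {x} → x ∈ attachment sel h → x ∈ segments tw sel
  attachment∈segments {sel = sel} h x∈ = ∈-++⁺ˡ (∈-concatMap⁺ (attachment sel) (lose (∈-allHalfEdges h) x∈))

  ribbon∈segments : ∀ {tw sel} e {x} → x ∈ ribbonSides (tw e) (sel e) e → x ∈ segments tw sel
  ribbon∈segments {tw} {sel} e x∈ =
    ∈-++⁺ʳ (concatMap (attachment sel) (allHalfEdges n))
           (∈-concatMap⁺ (λ e → ribbonSides (tw e) (sel e) e) (lose (∈-allFin e) x∈))

  ∈-segments⁻ : ∀ {tw sel x} → x ∈ segments tw sel →
                (Σ (HalfEdge n) λ h → x ∈ attachment sel h) ⊎ (Σ (Fin n) λ e → x ∈ ribbonSides (tw e) (sel e) e)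
  ∈-segments⁻ {tw} {sel} x∈ with ∈-++⁻ (concatMap (attachment sel) (allHalfEdges n)) x∈
  ... | inj₁ x∈att with h , _ , x∈h ← find (∈-concatMap⁻ (attachment sel) {xs = allHalfEdges n} x∈att) =
    inj₁ (h , x∈h)
  ... | inj₂ x∈sides
    with e , _ , x∈e ← find (∈-concatMap⁻ (λ e → ribbonSides (tw e) (sel e) e) {xs = allFin n} x∈sides) =
    inj₂ (e , x∈e)

  segment-within-edge : ∀ {tw sel} {x y} → (x , y) ∈ segments tw sel → proj₁ x ≡ proj₁ y
  segment-within-edge {tw} {sel} xy∈ with ∈-segments⁻ xy∈
  ... | inj₁ (h , xy∈h) with sel (proj₁ h) | xy∈h
  ...   | false | here refl = refl
  segment-within-edge {tw} {sel} xy∈ | inj₂ (e , xy∈e) with sel e | tw e | xy∈e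
  ... | true | true  | here refl         = refl
  ... | true | true  | there (here refl) = refl
  ... | true | false | here refl         = refl
  ... | true | false | there (here refl) = refl

  boundaryGraph-invariant : ∀ {nxt tw sel} {B : Set} (f : Fin n → B) →
                            (∀ h → f (proj₁ (nxt h)) ≡ f (proj₁ h)) →
                            ∀ {x y} → (x , y) ∈ boundaryGraph nxt tw sel → f (proj₁ x) ≡ f (proj₁ y)
  boundaryGraph-invariant f nxt-inv xy∈ with ∈-boundaryGraph⁻ xy∈
  ... | inj₁ (h , refl) = sym (nxt-inv h)
  ... | inj₂ xy∈seg     = cong f (segment-within-edge xy∈seg)

  ∈-boundaryGraph-next : ∀ {nxt nxt′ tw sel} h₁ h₂ → (∀ h → h ≢ h₁ → h ≢ h₂ → nxt h ≡ nxt′ h) →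
                         ∀ {x} → x ∈ boundaryGraph nxt tw sel →
                         x ∈ boundaryGraph nxt′ tw sel ⊎ (x ≡ arc nxt h₁ ⊎ x ≡ arc nxt h₂)
  ∈-boundaryGraph-next {nxt′ = nxt′} h₁ h₂ agree x∈ with ∈-boundaryGraph⁻ x∈
  ... | inj₂ x∈seg = inj₁ (segment∈boundaryGraph {nxt = nxt′} x∈seg)
  ... | inj₁ (h , refl) with h ≟h h₁ | h ≟h h₂
  ...   | yes refl | _        = inj₂ (inj₁ refl)
  ...   | no _     | yes refl = inj₂ (inj₂ refl)
  ...   | no h≢h₁  | no h≢h₂  =
    inj₁ (arc∈boundaryGraph {nxt = nxt′} h (sym (agree h h≢h₁ h≢h₂)))

renamePoint : ∀ {n m} → (Fin n → Fin m) → Point n → Point m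
renamePoint ι (e , i , j) = ι e , i , j

module _ {n m : ℕ} (ι : Fin n → Fin m) where

  ribbonSides-rename : ∀ t s e → ribbonSides t s (ι e) ≡ map (both (renamePoint ι)) (ribbonSides t s e)
  ribbonSides-rename true  true  e = refl
  ribbonSides-rename false true  e = refl
  ribbonSides-rename _     false e = refl

  attachment-rename : ∀ {sel sel′} e i → sel′ (ι e) ≡ sel e →
                      attachment sel′ (ι e , i) ≡ map (both (renamePoint ι)) (attachment sel (e , i))
  attachment-rename {sel} e i sel′≡sel rewrite sel′≡sel with sel e
  ... | true  = refl
  ... | false = refl

  segment-rename : ∀ {tw sel tw′ sel′} → (∀ e → tw′ (ι e) ≡ tw e) → (∀ e → sel′ (ι e) ≡ sel e) →
                   ∀ {x} → x ∈ segments tw sel → both (renamePoint ι) x ∈ segments tw′ sel′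
  segment-rename {tw} {sel} {tw′} {sel′} tw≡ sel≡ x∈ with ∈-segments⁻ x∈
  ... | inj₁ ((e , i) , x∈att) =
    attachment∈segments {tw = tw′} (ι e , i)
      (subst (_ ∈_) (sym (attachment-rename {sel} {sel′} e i (sel≡ e))) (∈-map⁺ _ x∈att))
  ... | inj₂ (e , x∈rib) =
    ribbon∈segments (ι e) (subst (_ ∈_) renamed (∈-map⁺ _ x∈rib))
    where
    renamed : map (both (renamePoint ι)) (ribbonSides (tw e) (sel e) e) ≡ ribbonSides (tw′ (ι e)) (sel′ (ι e)) (ι e)
    renamed = trans (sym (ribbonSides-rename (tw e) (sel e) e))
                    (sym (cong₂ (λ t s → ribbonSides t s (ι e)) (tw≡ e) (sel≡ e)))

enc-injective : ∀ {n} {x y : Point n} → enc x ≡ enc y → x ≡ y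
enc-injective {x = e , i , j} {e′ , i′ , j′} eq
  with refl , eq′ ← combine-injective e _ e′ _ eq
  with refl , refl ← combine-injective i j i′ j′ eq′ = refl

flip : Fin 2 → Fin 2
flip 0F = 1F
flip 1F = 0F

flip-involutive : ∀ i → flip (flip i) ≡ i
flip-involutive 0F = refl
flip-involutive 1F = refl

flip-fpf : ∀ i → flip i ≢ i
flip-fpf 0F ()
flip-fpf 1F ()

module _ {n : ℕ} (nxt prv : HalfEdge n → HalfEdge n)
         (prv-nxt : ∀ h → prv (nxt h) ≡ h) (nxt-prv : ∀ h → nxt (prv h) ≡ h)
         (tw sel : Fin n → Bool) where

  private
    corner : Point n → Point n
    corner (e , i , 0F) = endpoint (prv (e , i)) 1F
    corner (e , i , 1F) = endpoint (nxt (e , i)) 0F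

    corner-involutive : ∀ x → corner (corner x) ≡ x
    corner-involutive (e , i , 0F) = cong (λ h → endpoint h 0F) (nxt-prv (e , i))
    corner-involutive (e , i , 1F) = cong (λ h → endpoint h 1F) (prv-nxt (e , i))

    corner-fpf : ∀ x → corner x ≢ x
    corner-fpf (e , i , 0F) ()
    corner-fpf (e , i , 1F) ()

    across : Point n → Point n
    across (e , i , j) = if sel e then (if tw e then (e , flip i , j) else (e , flip i , flip j)) else (e , i , flip j)

    across-involutive : ∀ x → across (across x) ≡ x
    across-involutive (e , i , j) with sel e in se | tw e in te
    ... | true  | true  rewrite se | te | flip-involutive i = refl
    ... | true  | false rewrite se | te | flip-involutive i | flip-involutive j = refl
    ... | false | _     rewrite se | flip-involutive j = refl

    across-fpf : ∀ x → across x ≢ x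
    across-fpf (e , i , j) eq with sel e | tw e | eq
    ... | true  | true  | eq′ = flip-fpf i (cong (proj₁ ∘ proj₂) eq′)
    ... | true  | false | eq′ = flip-fpf i (cong (proj₁ ∘ proj₂) eq′)
    ... | false | _     | eq′ = flip-fpf j (cong (proj₂ ∘ proj₂) eq′)

    ribbonSide∈ : ∀ {e t s x} → tw e ≡ t → sel e ≡ s → x ∈ ribbonSides t s e → x ∈ segments tw sel
    ribbonSide∈ {e} te se x∈ = ribbon∈segments e (subst₂ (λ t s → _ ∈ ribbonSides t s e) (sym te) (sym se) x∈)

    across-segment : ∀ x → (x , across x) ∈ segments tw sel ⊎ (across x , x) ∈ segments tw sel
    across-segment (e , i , j) with sel e in se | tw e in te | i | j
    ... | false | _     | i  | 0F = inj₁ (attachment∈segments (e , i) attached)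
      where attached : ((e , i , 0F) , (e , i , 1F)) ∈ attachment sel (e , i)
            attached rewrite se = here refl
    ... | false | _     | i  | 1F = inj₂ (attachment∈segments (e , i) attached)
      where attached : ((e , i , 0F) , (e , i , 1F)) ∈ attachment sel (e , i)
            attached rewrite se = here refl
    ... | true  | true  | 0F | 1F = inj₁ (ribbonSide∈ te se (here refl))
    ... | true  | true  | 0F | 0F = inj₁ (ribbonSide∈ te se (there (here refl)))
    ... | true  | true  | 1F | 1F = inj₂ (ribbonSide∈ te se (here refl))
    ... | true  | true  | 1F | 0F = inj₂ (ribbonSide∈ te se (there (here refl)))
    ... | true  | false | 0F | 1F = inj₁ (ribbonSide∈ te se (here refl))
    ... | true  | false | 0F | 0F = inj₁ (ribbonSide∈ te se (there (here refl)))
    ... | true  | false | 1F | 0F = inj₂ (ribbonSide∈ te se (here refl))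
    ... | true  | false | 1F | 1F = inj₂ (ribbonSide∈ te se (there (here refl)))

  -- A boundary component alternates between arcs (corner) and segments (across), so the two ends
  -- of an arc stay connected when that arc is removed.
  arc-bypass : ∀ {ℓ} (R : Rel (Point n) ℓ) → Symmetric R → Transitive R →
               (∀ {x y} → (x , y) ∈ segments tw sel → R x y) →
               ∀ h₀ → (∀ h → h ≢ h₀ → R (endpoint h 1F) (endpoint (nxt h) 0F)) →
               R (endpoint (nxt h₀) 0F) (endpoint h₀ 1F)
  arc-bypass R R-sym R-trans R-segment h₀ R-arc =
    α-edge-bypass enc enc-injective corner across corner-involutive across-involutive corner-fpf across-fpf
                  R R-trans (endpoint h₀ 1F) R-across R-corner
    where
    R-across : ∀ x → R x (across x)
    R-across x with across-segment x
    ... | inj₁ x-across = R-segment x-across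
    ... | inj₂ across-x = R-sym (R-segment across-x)
    R-corner : ∀ x → x ≢ endpoint h₀ 1F → x ≢ corner (endpoint h₀ 1F) → R x (corner x)
    R-corner (e , i , 1F) x≢r _ = R-arc (e , i) (x≢r ∘ cong (λ h → endpoint h 1F))
    R-corner (e , i , 0F) _ x≢s =
      R-sym (subst (R (endpoint (prv (e , i)) 1F)) (cong (λ h → endpoint h 0F) (nxt-prv (e , i)))
                   (R-arc (prv (e , i)) prv≢h₀))
      where
      prv≢h₀ : prv (e , i) ≢ h₀
      prv≢h₀ eq = x≢s (trans (cong (λ h → endpoint h 0F) (sym (nxt-prv (e , i))))
                             (cong (λ h → endpoint (nxt h) 0F) eq))

encodeGraph : ∀ {n} → List (Point n × Point n) → List (Fin (n * 4) × Fin (n * 4))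
encodeGraph = map (both enc)

boundaryComponents : (X : CRG) → Subset (nE X) → ℕ
boundaryComponents X A = components (nE X * 4) (encodeGraph (boundaryEdges X A))

edgeOf : ∀ {n} → Fin (n * 4) → Fin n
edgeOf {n} z = proj₁ (remQuot {n} 4 z)

edgeOf-enc : ∀ {n} (x : Point n) → edgeOf (enc x) ≡ proj₁ x
edgeOf-enc (e , i , j) = cong proj₁ (remQuot-combine e (combine {2} {2} i j))

Incident : (X : CRG) → Fin (nV X) → Set
Incident X w = Σ (Fin (nE X)) λ e → Σ (Fin 2) λ i → vert X e i ≡ w

hasEdge⇔Incident : ∀ X {w} → hasEdge X w ≡ true ⇔ Incident X w
hasEdge⇔Incident X {w} = mk⇔ to from
  where
  at : Fin (nE X) → Fin 2 → Bool
  at e i = ⌊ vert X e i ≟ w ⌋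
  to : hasEdge X w ≡ true → Incident X w
  to h
    with e , _ , incident-e ← find (any⁻ (λ e → at e 0F ∨ at e 1F) (allFin (nE X)) (Equivalence.from T-≡ h))
    with Equivalence.to (T-∨ {at e 0F} {at e 1F}) incident-e
  ... | inj₁ at-0 = e , 0F , toWitness at-0
  ... | inj₂ at-1 = e , 1F , toWitness at-1
  from : Incident X w → hasEdge X w ≡ true
  from (e , i , vert≡w) =
    Equivalence.to T-≡ (any⁺ (λ e → at e 0F ∨ at e 1F) (lose (∈-allFin e) (incident i vert≡w)))
    where
    incident : ∀ i → vert X e i ≡ w → T (at e 0F ∨ at e 1F)
    incident 0F eq = Equivalence.from (T-∨ {at e 0F} {at e 1F}) (inj₁ (fromWitness eq))
    incident 1F eq = Equivalence.from (T-∨ {at e 0F} {at e 1F}) (inj₂ (fromWitness eq))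

hasEdge⁺ : ∀ X {w} → Incident X w → hasEdge X w ≡ true
hasEdge⁺ X = Equivalence.from (hasEdge⇔Incident X)

hasEdge⁻ : ∀ X {w} → hasEdge X w ≡ true → Incident X w
hasEdge⁻ X = Equivalence.to (hasEdge⇔Incident X)

hasEdge-cong : ∀ X Y {x y} → (Incident X x → Incident Y y) → (Incident Y y → Incident X x) →
               hasEdge X x ≡ hasEdge Y y
hasEdge-cong X Y X→Y Y→X =
  ⇔→≡ {z = true} (mk⇔ (hasEdge⁺ Y ∘ X→Y ∘ hasEdge⁻ X) (hasEdge⁺ X ∘ Y→X ∘ hasEdge⁻ Y))

hasEdge-isolated : ∀ X {w} → IsolatedV X w → hasEdge X w ≡ false
hasEdge-isolated X {w} isolated with hasEdge X w in has
... | false = refl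
... | true with e , i , eq ← hasEdge⁻ X has = ⊥-elim (isolated e i eq)

hasEdge-corner : ∀ X h → hasEdge X (vert X (proj₁ h) (proj₂ h)) ≡ true
hasEdge-corner X (e , i) = hasEdge⁺ X (e , i , refl)

isolatedOff : (X : CRG) → Fin (nV X) → ℕ
isolatedOff X w = count (pred (nV X)) (not ∘ hasEdge X ∘ insert w)

isolatedCount-insert : ∀ X w → isolatedCount X ≡ indicator (not (hasEdge X w)) + isolatedOff X w
isolatedCount-insert X w = trans (length-filter-allFin (nV X) _) (count-insert (not ∘ hasEdge X) w)

-- Disjoint unions and joins

data SideView (m n : ℕ) : Fin (m + n) → Set where
  left  : ∀ i → SideView m n (i ↑ˡ n)
  right : ∀ j → SideView m n (m ↑ʳ j)

sideView : ∀ m n x → SideView m n x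
sideView zero    n x       = right x
sideView (suc m) n zero    = left zero
sideView (suc m) n (suc x) with sideView m n x
... | left i  = left (suc i)
... | right j = right j

isLeft : ∀ m {n} → Fin (m + n) → Bool
isLeft m x = [ const true , const false ]′ (splitAt m x)

isLeft-↑ˡ : ∀ m n (i : Fin m) → isLeft m (i ↑ˡ n) ≡ true
isLeft-↑ˡ m n i rewrite splitAt-↑ˡ m i n = refl

isLeft-↑ʳ : ∀ m n (j : Fin n) → isLeft m (m ↑ʳ j) ≡ false
isLeft-↑ʳ m n j rewrite splitAt-↑ʳ m n j = refl

isLeft-separates : ∀ m n (i : Fin m) (j : Fin n) → isLeft m (i ↑ˡ n) ≢ isLeft m (m ↑ʳ j)
isLeft-separates m n i j eq with () ← trans (sym (isLeft-↑ˡ m n i)) (trans eq (isLeft-↑ʳ m n j))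

↑ˡ≢↑ʳ : ∀ {m n} (i : Fin m) (j : Fin n) → i ↑ˡ n ≢ m ↑ʳ j
↑ˡ≢↑ʳ {m} {n} i j = isLeft-separates m n i j ∘ cong (isLeft m)

does-↑ʳ≟↑ʳ : ∀ m {n} (i j : Fin n) → does (m ↑ʳ i ≟ m ↑ʳ j) ≡ does (i ≟ j)
does-↑ʳ≟↑ʳ zero    i j = refl
does-↑ʳ≟↑ʳ (suc m) i j = does-↑ʳ≟↑ʳ m i j

merge-↑ˡ : ∀ {m n} (a : Fin n) (b : Fin (m + n)) (i : Fin m) → merge (m ↑ʳ a) b (i ↑ˡ n) ≡ i ↑ˡ n
merge-↑ˡ {m} {n} a b i rewrite dec-false (i ↑ˡ n ≟ m ↑ʳ a) (↑ˡ≢↑ʳ i a) = refl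

merge-↑ʳ : ∀ {m n} (a : Fin n) (b : Fin (m + n)) (j : Fin n) →
           merge (m ↑ʳ a) b (m ↑ʳ j) ≡ (if ⌊ j ≟ a ⌋ then b else m ↑ʳ j)
merge-↑ʳ {m} a b j rewrite does-↑ʳ≟↑ʳ m j a | isYes≗does (j ≟ a) = refl

merge-self : ∀ {n} (a b : Fin n) → merge a b a ≡ b
merge-self a b rewrite dec-true (a ≟ a) refl = refl

insert-remove : ∀ {n} (v x : Fin n) (x≢v : x ≢ v) → insert v (remove v x x≢v) ≡ x
insert-remove {suc n} v x x≢v = punchIn-punchOut (x≢v ∘ sym)

remove-insert : ∀ {n} (v : Fin n) {x y} → x ≡ insert v y → (x≢v : x ≢ v) → remove v x x≢v ≡ y
remove-insert {suc n} v refl x≢v = trans (punchOut-cong v refl) (punchOut-punchIn v)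

remove-irrelevant : ∀ {n} (v x : Fin n) (p q : x ≢ v) → remove v x p ≡ remove v x q
remove-irrelevant {suc n} v x p q = punchOut-cong v refl

suc-pred : ∀ {n} → Fin n → suc (pred n) ≡ n
suc-pred {suc n} _ = refl

insert≢ : ∀ {n} (v : Fin n) y → insert v y ≢ v
insert≢ {suc n} v y = punchInᵢ≢i v y

module JoinOf (G G′ : CRG) (s : Site G) (s′ : Site G′) where

  open ≡-Reasoning

  J U : CRG
  J = join G G′ s s′
  U = G ⊔ G′

  v : Fin (nV G)
  v = siteVertex G s
  v′ : Fin (nV G′)
  v′ = siteVertex G′ s′

  nV-join : suc (nV J) ≡ nV U
  nV-join = trans (sym (+-suc (nV G) (pred (nV G′)))) (cong (nV G +_) (suc-pred v′))

  vert-⊔ˡ : ∀ f i → vert U (f ↑ˡ nE G′) i ≡ vert G f i ↑ˡ nV G′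
  vert-⊔ˡ f i rewrite splitAt-↑ˡ (nE G) f (nE G′) = refl

  vert-⊔ʳ : ∀ f i → vert U (nE G ↑ʳ f) i ≡ nV G ↑ʳ vert G′ f i
  vert-⊔ʳ f i rewrite splitAt-↑ʳ (nE G) (nE G′) f = refl

  vert-joinˡ : ∀ f i → vert J (f ↑ˡ nE G′) i ≡ vert G f i ↑ˡ pred (nV G′)
  vert-joinˡ f i rewrite splitAt-↑ˡ (nE G) f (nE G′) = refl

  vert-joinʳ-glued : ∀ f i → vert G′ f i ≡ v′ → vert J (nE G ↑ʳ f) i ≡ v ↑ˡ pred (nV G′)
  vert-joinʳ-glued f i at-v′ rewrite splitAt-↑ʳ (nE G) (nE G′) f with vert G′ f i ≟ v′
  ... | yes _     = refl
  ... | no  ≢v′   = ⊥-elim (≢v′ at-v′)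

  vert-joinʳ-kept : ∀ f i (≢v′ : vert G′ f i ≢ v′) →
                    vert J (nE G ↑ʳ f) i ≡ nV G ↑ʳ remove v′ (vert G′ f i) ≢v′
  vert-joinʳ-kept f i ≢v′ rewrite splitAt-↑ʳ (nE G) (nE G′) f with vert G′ f i ≟ v′
  ... | yes at-v′ = ⊥-elim (≢v′ at-v′)
  ... | no  ≢v′′  = cong (nV G ↑ʳ_) (remove-irrelevant v′ _ ≢v′′ ≢v′)

  vClass′ vClass : Fin (kV G + kV G′)
  vClass′ = kV G ↑ʳ vcol G′ v′
  vClass = vcol G v ↑ˡ kV G′

  mergeV : Fin (kV G + kV G′) → Fin (kV G + kV G′)
  mergeV = merge vClass′ vClass

  vcol-⊔ˡ : ∀ w → vcol U (w ↑ˡ nV G′) ≡ vcol G w ↑ˡ kV G′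
  vcol-⊔ˡ w rewrite splitAt-↑ˡ (nV G) w (nV G′) = refl

  vcol-⊔ʳ : ∀ w → vcol U (nV G ↑ʳ w) ≡ kV G ↑ʳ vcol G′ w
  vcol-⊔ʳ w rewrite splitAt-↑ʳ (nV G) (nV G′) w = refl

  vcol-joinˡ : ∀ w → vcol J (w ↑ˡ pred (nV G′)) ≡ vcol G w ↑ˡ kV G′
  vcol-joinˡ w rewrite splitAt-↑ˡ (nV G) w (pred (nV G′)) = refl

  vcol-joinʳ : ∀ y → vcol J (nV G ↑ʳ y) ≡ mergeV (kV G ↑ʳ vcol G′ (insert v′ y))
  vcol-joinʳ y rewrite splitAt-↑ʳ (nV G) (pred (nV G′)) y
                     | merge-↑ʳ (vcol G′ v′) vClass (vcol G′ (insert v′ y)) = refl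

  vcol-end : ∀ e i → vcol J (vert J e i) ≡ mergeV (vcol U (vert U e i))
  vcol-end e i with sideView (nE G) (nE G′) e
  ... | left f = begin
    vcol J (vert J (f ↑ˡ nE G′) i)          ≡⟨ cong (vcol J) (vert-joinˡ f i) ⟩
    vcol J (vert G f i ↑ˡ pred (nV G′))     ≡⟨ vcol-joinˡ (vert G f i) ⟩
    vcol G (vert G f i) ↑ˡ kV G′            ≡⟨ sym (merge-↑ˡ (vcol G′ v′) vClass _) ⟩
    mergeV (vcol G (vert G f i) ↑ˡ kV G′)   ≡⟨ cong mergeV (sym (vcol-⊔ˡ (vert G f i))) ⟩
    mergeV (vcol U (vert G f i ↑ˡ nV G′))   ≡⟨ cong (mergeV ∘ vcol U) (sym (vert-⊔ˡ f i)) ⟩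
    mergeV (vcol U (vert U (f ↑ˡ nE G′) i)) ∎
  ... | right f =
    trans (vcol-joinʳ-end (vert G′ f i ≟ v′))
          (cong mergeV (sym (trans (cong (vcol U) (vert-⊔ʳ f i)) (vcol-⊔ʳ (vert G′ f i)))))
    where
    vcol-joinʳ-end : Dec (vert G′ f i ≡ v′) →
                     vcol J (vert J (nE G ↑ʳ f) i) ≡ mergeV (kV G ↑ʳ vcol G′ (vert G′ f i))
    vcol-joinʳ-end (yes at-v′) = begin
      vcol J (vert J (nE G ↑ʳ f) i)            ≡⟨ cong (vcol J) (vert-joinʳ-glued f i at-v′) ⟩
      vcol J (v ↑ˡ pred (nV G′))               ≡⟨ vcol-joinˡ v ⟩
      vClass                                   ≡⟨ sym (merge-self vClass′ vClass) ⟩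
      mergeV vClass′                           ≡⟨ cong (λ w → mergeV (kV G ↑ʳ vcol G′ w)) (sym at-v′) ⟩
      mergeV (kV G ↑ʳ vcol G′ (vert G′ f i))   ∎
    vcol-joinʳ-end (no ≢v′) = begin
      vcol J (vert J (nE G ↑ʳ f) i)
        ≡⟨ cong (vcol J) (vert-joinʳ-kept f i ≢v′) ⟩
      vcol J (nV G ↑ʳ remove v′ _ ≢v′)
        ≡⟨ vcol-joinʳ _ ⟩
      mergeV (kV G ↑ʳ vcol G′ (insert v′ (remove v′ _ ≢v′)))
        ≡⟨ cong (λ w → mergeV (kV G ↑ʳ vcol G′ w)) (insert-remove v′ _ ≢v′) ⟩
      mergeV (kV G ↑ʳ vcol G′ (vert G′ f i))
        ∎

  vcol-⊔-side : ∀ e i → isLeft (kV G) (vcol U (vert U e i)) ≡ isLeft (nE G) e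
  vcol-⊔-side e i with sideView (nE G) (nE G′) e
  ... | left f rewrite vert-⊔ˡ f i | vcol-⊔ˡ (vert G f i) =
    trans (isLeft-↑ˡ (kV G) (kV G′) _) (sym (isLeft-↑ˡ (nE G) (nE G′) f))
  ... | right f rewrite vert-⊔ʳ f i | vcol-⊔ʳ (vert G′ f i) =
    trans (isLeft-↑ʳ (kV G) (kV G′) _) (sym (isLeft-↑ʳ (nE G) (nE G′) f))

  bClass′ bClass : Fin (kB G + kB G′)
  bClass′ = kB G ↑ʳ siteBColour G′ s′
  bClass = siteBColour G s ↑ˡ kB G′

  mergeB : Fin (kB G + kB G′) → Fin (kB G + kB G′)
  mergeB = merge bClass′ bClass

  bcol-⊔ˡ : ∀ f i j → bcol U (inj₂ (f ↑ˡ nE G′ , i , j)) ≡ bcol G (inj₂ (f , i , j)) ↑ˡ kB G′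
  bcol-⊔ˡ f i j rewrite splitAt-↑ˡ (nE G) f (nE G′) = refl

  bcol-⊔ʳ : ∀ f i j → bcol U (inj₂ (nE G ↑ʳ f , i , j)) ≡ kB G ↑ʳ bcol G′ (inj₂ (f , i , j))
  bcol-⊔ʳ f i j rewrite splitAt-↑ʳ (nE G) (nE G′) f = refl

  bcol-point : ∀ e i j → bcol J (inj₂ (e , i , j)) ≡ mergeB (bcol U (inj₂ (e , i , j)))
  bcol-point e i j with sideView (nE G) (nE G′) e
  ... | left f rewrite bcol-⊔ˡ f i j | splitAt-↑ˡ (nE G) f (nE G′) =
    sym (merge-↑ˡ (siteBColour G′ s′) bClass (bcol G (inj₂ (f , i , j))))
  ... | right f rewrite bcol-⊔ʳ f i j | splitAt-↑ʳ (nE G) (nE G′) f =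
    sym (merge-↑ʳ (siteBColour G′ s′) bClass (bcol G′ (inj₂ (f , i , j))))

  bcol-⊔-side : ∀ e i j → isLeft (kB G) (bcol U (inj₂ (e , i , j))) ≡ isLeft (nE G) e
  bcol-⊔-side e i j with sideView (nE G) (nE G′) e
  ... | left f rewrite bcol-⊔ˡ f i j = trans (isLeft-↑ˡ (kB G) (kB G′) _) (sym (isLeft-↑ˡ (nE G) (nE G′) f))
  ... | right f rewrite bcol-⊔ʳ f i j = trans (isLeft-↑ʳ (kB G) (kB G′) _) (sym (isLeft-↑ʳ (nE G) (nE G′) f))

  rV-join : ∀ A → rV J A ≡ rV U A
  rV-join A =
    rank-selectedEdges-merge A (λ e i → vcol U (vert U e i)) (λ e i → vcol J (vert J e i)) vcol-end
      (isLeft (kV G)) (λ e → trans (vcol-⊔-side e 0F) (sym (vcol-⊔-side e 1F)))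
      (isLeft-separates (kV G) (kV G′) (vcol G v) (vcol G′ v′) ∘ sym)

  rB-join : ∀ A → rB J A ≡ rB U A
  rB-join A =
    rank-selectedEdges-merge A (λ e i → bcol U (inj₂ (e , 0F , i))) (λ e i → bcol J (inj₂ (e , 0F , i)))
      (λ e → bcol-point e 0F) (isLeft (kB G)) (λ e → trans (bcol-⊔-side e 0F 0F) (sym (bcol-⊔-side e 0F 1F)))
      (isLeft-separates (kB G) (kB G′) (siteBColour G s) (siteBColour G′ s′) ∘ sym)

  hasEdge-⊔ˡ : ∀ w → hasEdge U (w ↑ˡ nV G′) ≡ hasEdge G w
  hasEdge-⊔ˡ w = hasEdge-cong U G to from
    where
    to : Incident U (w ↑ˡ nV G′) → Incident G w
    to (e , i , eq) with sideView (nE G) (nE G′) e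
    ... | left f  = f , i , ↑ˡ-injective (nV G′) _ _ (trans (sym (vert-⊔ˡ f i)) eq)
    ... | right f = ⊥-elim (↑ˡ≢↑ʳ w _ (trans (sym eq) (vert-⊔ʳ f i)))
    from : Incident G w → Incident U (w ↑ˡ nV G′)
    from (f , i , eq) = f ↑ˡ nE G′ , i , trans (vert-⊔ˡ f i) (cong (_↑ˡ nV G′) eq)

  hasEdge-⊔ʳ : ∀ w → hasEdge U (nV G ↑ʳ w) ≡ hasEdge G′ w
  hasEdge-⊔ʳ w = hasEdge-cong U G′ to from
    where
    to : Incident U (nV G ↑ʳ w) → Incident G′ w
    to (e , i , eq) with sideView (nE G) (nE G′) e
    ... | left f  = ⊥-elim (↑ˡ≢↑ʳ _ w (trans (sym (vert-⊔ˡ f i)) eq))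
    ... | right f = f , i , ↑ʳ-injective (nV G) _ _ (trans (sym (vert-⊔ʳ f i)) eq)
    from : Incident G′ w → Incident U (nV G ↑ʳ w)
    from (f , i , eq) = nE G ↑ʳ f , i , trans (vert-⊔ʳ f i) (cong (nV G ↑ʳ_) eq)

  hasEdge-joinˡ : ∀ w → w ≢ v → hasEdge J (w ↑ˡ pred (nV G′)) ≡ hasEdge G w
  hasEdge-joinˡ w w≢v = hasEdge-cong J G to from
    where
    to : Incident J (w ↑ˡ pred (nV G′)) → Incident G w
    to (e , i , eq) with sideView (nE G) (nE G′) e
    ... | left f = f , i , ↑ˡ-injective (pred (nV G′)) _ _ (trans (sym (vert-joinˡ f i)) eq)
    ... | right f with vert G′ f i ≟ v′
    ...   | yes at-v′ =
      ⊥-elim (w≢v (↑ˡ-injective (pred (nV G′)) _ _ (trans (sym eq) (vert-joinʳ-glued f i at-v′))))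
    ...   | no  ≢v′   = ⊥-elim (↑ˡ≢↑ʳ w _ (trans (sym eq) (vert-joinʳ-kept f i ≢v′)))
    from : Incident G w → Incident J (w ↑ˡ pred (nV G′))
    from (f , i , eq) = f ↑ˡ nE G′ , i , trans (vert-joinˡ f i) (cong (_↑ˡ pred (nV G′)) eq)

  hasEdge-joinʳ : ∀ y → hasEdge J (nV G ↑ʳ y) ≡ hasEdge G′ (insert v′ y)
  hasEdge-joinʳ y = hasEdge-cong J G′ to from
    where
    to : Incident J (nV G ↑ʳ y) → Incident G′ (insert v′ y)
    to (e , i , eq) with sideView (nE G) (nE G′) e
    ... | left f = ⊥-elim (↑ˡ≢↑ʳ _ y (trans (sym (vert-joinˡ f i)) eq))
    ... | right f with vert G′ f i ≟ v′
    ...   | yes at-v′ = ⊥-elim (↑ˡ≢↑ʳ v y (trans (sym (vert-joinʳ-glued f i at-v′)) eq))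
    ...   | no  ≢v′   =
      f , i , trans (sym (insert-remove v′ _ ≢v′))
                    (cong (insert v′) (↑ʳ-injective (nV G) _ _ (trans (sym (vert-joinʳ-kept f i ≢v′)) eq)))
    from : Incident G′ (insert v′ y) → Incident J (nV G ↑ʳ y)
    from (f , i , eq) =
      nE G ↑ʳ f , i , trans (vert-joinʳ-kept f i ≢v′) (cong (nV G ↑ʳ_) (remove-insert v′ eq ≢v′))
      where
      ≢v′ : vert G′ f i ≢ v′
      ≢v′ = insert≢ v′ y ∘ trans (sym eq)

  hasEdge-join-v : hasEdge J (v ↑ˡ pred (nV G′)) ≡ hasEdge G v ∨ hasEdge G′ v′
  hasEdge-join-v = ⇔→≡ {z = true} (mk⇔ to from)
    where
    to : hasEdge J (v ↑ˡ pred (nV G′)) ≡ true → (hasEdge G v ∨ hasEdge G′ v′) ≡ true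
    to h with e , i , eq ← hasEdge⁻ J h | sideView (nE G) (nE G′) e
    ... | left f rewrite hasEdge⁺ G (f , i , ↑ˡ-injective (pred (nV G′)) _ _ (trans (sym (vert-joinˡ f i)) eq)) = refl
    ... | right f with vert G′ f i ≟ v′
    ...   | yes at-v′ rewrite hasEdge⁺ G′ (f , i , at-v′) = ∨-zeroʳ (hasEdge G v)
    ...   | no  ≢v′   = ⊥-elim (↑ˡ≢↑ʳ v _ (trans (sym eq) (vert-joinʳ-kept f i ≢v′)))
    from : (hasEdge G v ∨ hasEdge G′ v′) ≡ true → hasEdge J (v ↑ˡ pred (nV G′)) ≡ true
    from h with hasEdge G v in hG
    ... | true  with f , i , eq ← hasEdge⁻ G hG =
      hasEdge⁺ J (f ↑ˡ nE G′ , i , trans (vert-joinˡ f i) (cong (_↑ˡ pred (nV G′)) eq))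
    ... | false with f , i , eq ← hasEdge⁻ G′ h =
      hasEdge⁺ J (nE G ↑ʳ f , i , vert-joinʳ-glued f i eq)

  isolatedCount-⊔ : isolatedCount U ≡ isolatedCount G + isolatedCount G′
  isolatedCount-⊔ = begin
    isolatedCount U
      ≡⟨ length-filter-allFin (nV G + nV G′) _ ⟩
    count (nV G + nV G′) (not ∘ hasEdge U)
      ≡⟨ count-+ (nV G) (nV G′) _ ⟩
    count (nV G) (not ∘ hasEdge U ∘ (_↑ˡ nV G′)) + count (nV G′) (not ∘ hasEdge U ∘ (nV G ↑ʳ_))
      ≡⟨ cong₂ _+_ (count-cong (nV G) (cong not ∘ hasEdge-⊔ˡ))
                   (count-cong (nV G′) (cong not ∘ hasEdge-⊔ʳ)) ⟩
    count (nV G) (not ∘ hasEdge G) + count (nV G′) (not ∘ hasEdge G′)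
      ≡⟨ sym (cong₂ _+_ (length-filter-allFin (nV G) _) (length-filter-allFin (nV G′) _)) ⟩
    isolatedCount G + isolatedCount G′
      ∎

  isolatedCount-join′ :
    isolatedCount J ≡ (indicator (not (hasEdge G v ∨ hasEdge G′ v′)) + isolatedOff G v) + isolatedOff G′ v′
  isolatedCount-join′ = begin
    isolatedCount J
      ≡⟨ length-filter-allFin (nV G + pred (nV G′)) _ ⟩
    count (nV G + pred (nV G′)) (not ∘ hasEdge J)
      ≡⟨ count-+ (nV G) (pred (nV G′)) _ ⟩
    count (nV G) (not ∘ hasEdge J ∘ (_↑ˡ pred (nV G′))) + count (pred (nV G′)) (not ∘ hasEdge J ∘ (nV G ↑ʳ_))
      ≡⟨ cong₂ _+_ (count-insert _ v) (count-cong (pred (nV G′)) (cong not ∘ hasEdge-joinʳ)) ⟩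
    (indicator (not (hasEdge J (v ↑ˡ pred (nV G′))))
       + count (pred (nV G)) (not ∘ hasEdge J ∘ (_↑ˡ pred (nV G′)) ∘ insert v))
      + isolatedOff G′ v′
      ≡⟨ cong (_+ isolatedOff G′ v′)
              (cong₂ _+_ (cong (indicator ∘ not) hasEdge-join-v)
                         (count-cong (pred (nV G)) (λ y → cong not (hasEdge-joinˡ (insert v y) (insert≢ v y))))) ⟩
    (indicator (not (hasEdge G v ∨ hasEdge G′ v′)) + isolatedOff G v) + isolatedOff G′ v′
      ∎

  isolatedCount-join : isolatedCount U ≡ isolatedCount J + indicator (not (hasEdge G v ∧ hasEdge G′ v′))
  isolatedCount-join = begin
    isolatedCount U
      ≡⟨ isolatedCount-⊔ ⟩
    isolatedCount G + isolatedCount G′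
      ≡⟨ cong₂ _+_ (isolatedCount-insert G v) (isolatedCount-insert G′ v′) ⟩
    (indicator (not a) + isolatedOff G v) + (indicator (not b) + isolatedOff G′ v′)
      ≡⟨ rearrange (indicator (not a)) (indicator (not b)) (indicator (not (a ∨ b))) (indicator (not (a ∧ b)))
                   (isolatedOff G v) (isolatedOff G′ v′) (indicator-not-∨-∧ a b) ⟩
    ((indicator (not (a ∨ b)) + isolatedOff G v) + isolatedOff G′ v′) + indicator (not (a ∧ b))
      ≡⟨ cong (_+ indicator (not (a ∧ b))) (sym isolatedCount-join′) ⟩
    isolatedCount J + indicator (not (a ∧ b))
      ∎
    where
    a = hasEdge G v
    b = hasEdge G′ v′
    rearrange : ∀ x y z w r r′ → x + y ≡ z + w → (x + r) + (y + r′) ≡ ((z + r) + r′) + w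
    rearrange x y z w r r′ eq = begin
      (x + r) + (y + r′)  ≡⟨ interchange x r y r′ ⟩
      (x + y) + (r + r′)  ≡⟨ cong (_+ (r + r′)) eq ⟩
      (z + w) + (r + r′)  ≡⟨ move-right z w r r′ ⟩
      ((z + r) + r′) + w  ∎
      where
      move-right : ∀ z w r r′ → (z + w) + (r + r′) ≡ ((z + r) + r′) + w
      move-right = solve-∀

  -- Exactly one of the two counts drops: two boundary components merge when both sites are
  -- corners, and an isolated vertex disappears otherwise.
  bdry-join-from-components : ∀ A →
    boundaryComponents U A ≡ boundaryComponents J A + indicator (hasEdge G v ∧ hasEdge G′ v′) →
    bdry U A ≡ suc (bdry J A)
  bdry-join-from-components A components-eq = begin
    boundaryComponents U A + isolatedCount U
      ≡⟨ cong₂ _+_ components-eq isolatedCount-join ⟩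
    (boundaryComponents J A + indicator corners) + (isolatedCount J + indicator (not corners))
      ≡⟨ one-drops (boundaryComponents J A) (isolatedCount J) corners ⟩
    suc (boundaryComponents J A + isolatedCount J)
      ∎
    where
    corners = hasEdge G v ∧ hasEdge G′ v′
    one-drops : ∀ c i b → (c + indicator b) + (i + indicator (not b)) ≡ suc (c + i)
    one-drops c i true  = cong₂ _+_ (+-indicator-true c refl) (+-identityʳ i)
    one-drops c i false = trans (cong₂ _+_ (+-identityʳ c) (+-indicator-true i refl)) (+-suc c i)

-- Joining two corners

module CornerJoin (G G′ : CRG) (wf′ : WF G′) (h₀ : HalfEdge (nE G)) (h₀′ : HalfEdge (nE G′))
                  (A : Subset (nE G + nE G′)) where

  private
    N = nE G + nE G′
    ι  = injH G G′
    ι′ = injH' G G′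

  J U : CRG
  J = join G G′ (cornerSite h₀) (cornerSite h₀′)
  U = G ⊔ G′

  next-⊔ˡ : ∀ h → next U (ι h) ≡ ι (next G h)
  next-⊔ˡ (f , i) rewrite splitAt-↑ˡ (nE G) f (nE G′) = refl

  next-⊔ʳ : ∀ h → next U (ι′ h) ≡ ι′ (next G′ h)
  next-⊔ʳ (f , i) rewrite splitAt-↑ʳ (nE G) (nE G′) f = refl

  ι≢ι′ : ∀ h h′ → ι h ≢ ι′ h′
  ι≢ι′ h h′ = ↑ˡ≢↑ʳ (proj₁ h) (proj₁ h′) ∘ cong proj₁

  ι′-injective : ∀ {h h′} → ι′ h ≡ ι′ h′ → h ≡ h′
  ι′-injective {f , i} {f′ , i′} eq with refl ← ↑ʳ-injective (nE G) f f′ (cong proj₁ eq) | cong proj₂ eq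
  ... | refl = refl

  next-join-h₀ : next J (ι h₀) ≡ ι′ (next G′ h₀′)
  next-join-h₀ with ι h₀ ≟h ι h₀
  ... | yes _   = refl
  ... | no  ≢   = ⊥-elim (≢ refl)

  next-join-h₀′ : next J (ι′ h₀′) ≡ ι (next G h₀)
  next-join-h₀′ with ι′ h₀′ ≟h ι h₀ | ι′ h₀′ ≟h ι′ h₀′
  ... | yes eq | _     = ⊥-elim (ι≢ι′ h₀ h₀′ (sym eq))
  ... | no _   | yes _ = refl
  ... | no _   | no ≢  = ⊥-elim (≢ refl)

  next-join-other : ∀ h → h ≢ ι h₀ → h ≢ ι′ h₀′ → next J h ≡ next U h
  next-join-other h ≢h₀ ≢h₀′ with h ≟h ι h₀ | h ≟h ι′ h₀′
  ... | yes eq | _      = ⊥-elim (≢h₀ eq)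
  ... | no _   | yes eq = ⊥-elim (≢h₀′ eq)
  ... | no _   | no _   = refl

  BJ BU : List (Point N × Point N)
  BJ = boundaryEdges J A
  BU = boundaryEdges U A

  p q r s : Point N
  p = endpoint (ι h₀) 1F
  q = endpoint (ι (next G h₀)) 0F
  r = endpoint (ι′ h₀′) 1F
  s = endpoint (ι′ (next G′ h₀′)) 0F

  arc∈ : ∀ {nxt : HalfEdge N → HalfEdge N} h {k} → nxt h ≡ k →
         (endpoint h 1F , endpoint k 0F) ∈ boundaryGraph nxt (twist U) (lookup A)
  arc∈ {nxt} = arc∈boundaryGraph {nxt = nxt}

  BU-cases : ∀ {x} → x ∈ BU → x ∈ BJ ⊎ (x ≡ (p , q) ⊎ x ≡ (r , s))
  BU-cases x∈ with ∈-boundaryGraph-next {nxt = next U} {nxt′ = next J} (ι h₀) (ι′ h₀′)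
                     (λ h ≢h₀ ≢h₀′ → sym (next-join-other h ≢h₀ ≢h₀′)) x∈
  ... | inj₁ x∈BJ        = inj₁ x∈BJ
  ... | inj₂ (inj₁ refl) = inj₂ (inj₁ (arc-≡ {nxt = next U} (ι h₀) (next-⊔ˡ h₀)))
  ... | inj₂ (inj₂ refl) = inj₂ (inj₂ (arc-≡ {nxt = next U} (ι′ h₀′) (next-⊔ʳ h₀′)))

  BJ-cases : ∀ {x} → x ∈ BJ → x ∈ BU ⊎ (x ≡ (p , s) ⊎ x ≡ (r , q))
  BJ-cases x∈ with ∈-boundaryGraph-next {nxt = next J} {nxt′ = next U} (ι h₀) (ι′ h₀′) next-join-other x∈
  ... | inj₁ x∈BU        = inj₁ x∈BU
  ... | inj₂ (inj₁ refl) = inj₂ (inj₁ (arc-≡ {nxt = next J} (ι h₀) next-join-h₀))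
  ... | inj₂ (inj₂ refl) = inj₂ (inj₂ (arc-≡ {nxt = next J} (ι′ h₀′) next-join-h₀′))

  s~r : Connected BJ s r
  s~r = arc-bypass (next G′) (WF.prev wf′) (WF.prev-next wf′) (WF.next-prev wf′)
                   (twist G′) (lookup A ∘ (nE G ↑ʳ_)) R reverse _◅◅_ R-segment h₀′ R-arc
    where
    R : Point (nE G′) → Point (nE G′) → Set
    R x y = Connected BJ (renamePoint (nE G ↑ʳ_) x) (renamePoint (nE G ↑ʳ_) y)
    twist-ʳ : ∀ f → twist U (nE G ↑ʳ f) ≡ twist G′ f
    twist-ʳ f rewrite splitAt-↑ʳ (nE G) (nE G′) f = refl
    R-segment : ∀ {x y} → (x , y) ∈ segments (twist G′) (lookup A ∘ (nE G ↑ʳ_)) → R x y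
    R-segment xy∈ =
      edge (segment∈boundaryGraph {nxt = next J} (segment-rename (nE G ↑ʳ_) twist-ʳ (λ _ → refl) xy∈))
    R-arc : ∀ h → h ≢ h₀′ → R (endpoint h 1F) (endpoint (next G′ h) 0F)
    R-arc h ≢h₀′ =
      edge (arc∈ {nxt = next J} (ι′ h)
                 (trans (next-join-other (ι′ h) (ι≢ι′ h₀ h ∘ sym) (≢h₀′ ∘ ι′-injective)) (next-⊔ʳ h)))

  BU-side : ∀ {x y} → (x , y) ∈ BU → isLeft (nE G) (proj₁ x) ≡ isLeft (nE G) (proj₁ y)
  BU-side = boundaryGraph-invariant (isLeft (nE G)) next-side
    where
    next-side : ∀ h → isLeft (nE G) (proj₁ (next U h)) ≡ isLeft (nE G) (proj₁ h)
    next-side (e , i) with sideView (nE G) (nE G′) e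
    ... | left f  rewrite next-⊔ˡ (f , i) = trans (isLeft-↑ˡ (nE G) (nE G′) _) (sym (isLeft-↑ˡ (nE G) (nE G′) f))
    ... | right f rewrite next-⊔ʳ (f , i) = trans (isLeft-↑ʳ (nE G) (nE G′) _) (sym (isLeft-↑ʳ (nE G) (nE G′) f))

  ¬p~r : ¬ Connected (encodeGraph BU) (enc p) (enc r)
  ¬p~r = separated⇒¬connected (isLeft (nE G) ∘ edgeOf) encoded-side p≁r
    where
    encoded-side : ∀ {a b} → Adjacent (encodeGraph BU) a b → isLeft (nE G) (edgeOf a) ≡ isLeft (nE G) (edgeOf b)
    encoded-side ab∈ with (x , y) , xy∈ , refl ← ∈-map⁻ (both enc) ab∈
      rewrite edgeOf-enc x | edgeOf-enc y = BU-side xy∈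
    p≁r : isLeft (nE G) (edgeOf (enc p)) ≢ isLeft (nE G) (edgeOf (enc r))
    p≁r rewrite edgeOf-enc p | edgeOf-enc r = isLeft-separates (nE G) (nE G′) (proj₁ h₀) (proj₁ h₀′)

  components-corner : components (N * 4) (encodeGraph BU) ≡ suc (components (N * 4) (encodeGraph BJ))
  components-corner =
    components-switch (∈-map-cases (both enc) BU-cases) (∈-map-cases (both enc) BJ-cases)
      (∈-map⁺ (both enc) (arc∈ {nxt = next U} (ι h₀) (next-⊔ˡ h₀)))
      (∈-map⁺ (both enc) (arc∈ {nxt = next U} (ι′ h₀′) (next-⊔ʳ h₀′)))
      (∈-map⁺ (both enc) (arc∈ {nxt = next J} (ι h₀) next-join-h₀))
      (∈-map⁺ (both enc) (arc∈ {nxt = next J} (ι′ h₀′) next-join-h₀′))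
      (connected-map enc s~r) ¬p~r

bdry-join : ∀ G G′ → WF G′ → (s : Site G) (s′ : Site G′) → ValidSite G s → ValidSite G′ s′ →
            ∀ A → bdry (G ⊔ G′) A ≡ suc (bdry (join G G′ s s′) A)
bdry-join G G′ wf′ (cornerSite h₀) (cornerSite h₀′) _ _ A =
  JoinOf.bdry-join-from-components G G′ (cornerSite h₀) (cornerSite h₀′) A
    (trans (CornerJoin.components-corner G G′ wf′ h₀ h₀′ A)
           (sym (+-indicator-true _ (cong₂ _∧_ (hasEdge-corner G h₀) (hasEdge-corner G′ h₀′)))))
bdry-join G G′ _ (isoSite x) s′ x-isolated _ A =
  JoinOf.bdry-join-from-components G G′ (isoSite x) s′ A
    (sym (+-indicator-false _ (cong (_∧ hasEdge G′ (siteVertex G′ s′)) (hasEdge-isolated G x-isolated))))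
bdry-join G G′ _ (cornerSite h₀) (isoSite x′) _ x′-isolated A =
  JoinOf.bdry-join-from-components G G′ (cornerSite h₀) (isoSite x′) A
    (sym (+-indicator-false _
           (trans (cong (hasEdge G (vert G (proj₁ h₀) (proj₂ h₀)) ∧_) (hasEdge-isolated G′ x′-isolated))
                  (∧-zeroʳ _))))

suc-minus-suc : ∀ m n → ℤ.+ suc m ℤ.- ℤ.+ suc n ≡ ℤ.+ m ℤ.- ℤ.+ n
suc-minus-suc m n = trans (m-n≡m⊖n (suc m) (suc n)) (trans ([1+m]⊖[1+n]≡m⊖n m n) (sym (m-n≡m⊖n m n)))

module _ (G G′ : CRG) (wf′ : WF G′) (s : Site G) (s′ : Site G′)
         (valid : ValidSite G s) (valid′ : ValidSite G′ s′) where

  open JoinOf G G′ s s′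

  twoRho-join : ∀ A → twoRho J A ≡ twoRho U A
  twoRho-join A = begin
    ℤ.+ (∣ A ∣ + nV J) ℤ.- ℤ.+ bdry J A
      ≡⟨ sym (suc-minus-suc (∣ A ∣ + nV J) (bdry J A)) ⟩
    ℤ.+ suc (∣ A ∣ + nV J) ℤ.- ℤ.+ suc (bdry J A)
      ≡⟨ cong₂ (λ a b → ℤ.+ a ℤ.- ℤ.+ b) (trans (sym (+-suc ∣ A ∣ (nV J))) (cong (∣ A ∣ +_) nV-join))
                                         (sym (bdry-join G G′ wf′ s s′ valid valid′ A)) ⟩
    ℤ.+ (∣ A ∣ + nV U) ℤ.- ℤ.+ bdry U A
      ∎
    where open ≡-Reasoning

  monomial-join : ∀ A → monomial J A ≡ monomial U A
  monomial-join A rewrite rV-join A | twoRho-join A | rB-join fullSet | rB-join (∁ A) = refl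

  coeffP-join : ∀ m → coeffP J m ≡ coeffP U m
  coeffP-join m = cong length (filter-≐ (λ A → monomial J A ≟M m) (λ A → monomial U A ≟M m)
                                        ((λ {A} → trans (sym (monomial-join A))) , (λ {A} → trans (monomial-join A)))
                                        (allSubsets (nE G + nE G′)))

-- Only G' needs to be well formed: the boundary cycle argument runs on its side of the join.
proposition5p1 : (G G' : CRG) → WF G → WF G'
                 → (s : Site G) (s' : Site G') → ValidSite G s → ValidSite G' s'
                 → (m : Monomial) → coeffP (join G G' s s') m ≡ coeffP (G ⊔ G') m
proposition5p1 G G' _ wf' s s' valid valid' = coeffP-join G G' wf' s s' valid valid'
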